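{- Let $\lambda$ be a nonzero real number and let $Y$ be uniformly distributed on $[0,1]$. Let $e_{Y,\lambda}(t)=E[e_{\lambda}^{Y}(t)]-1=\frac{e_{\lambda}(t)-1}{\log e_{\lambda}(t)}-1$ and let $\bar e_{Y,\lambda}(t)$ be its compositional inverse. Then for nonnegative integers $k,n$ with $n\ge k+1$, \[ [t^{n}]\,\frac{1}{k!}\big(\bar{e}_{Y,\lambda}(t)\big)^{k}=\frac{1}{(n-k)\,k!}\,[t^{n-k-1}]\bigg(\frac{t}{\frac{e^{t}-1}{t}-1}\bigg)^{n-k}\frac{d}{dt}\bigg(\frac{\log_{\lambda}(e^{t})}{\frac{e^{t}-1}{t}-1}\bigg)^{k}. \]
   Context: $e_{\lambda}(t)=(1+\lambda t)^{1/\lambda}$, so $\log e_{\lambda}(t)=\frac1\lambda\log(1+\lambda t)$; $\log_{\lambda}(x)=\frac{1}{\lambda}(x^{\lambda}-1)$, so $\log_{\lambda}(e^t)=\frac{e^{\lambda t}-1}{\lambda}$. For $Y\sim U[0,1]$, $E[e_{\lambda}^{Y}(t)]=E[(1+\lambda t)^{Y/\lambda}]=\frac{e_{\lambda}(t)-1}{\log e_{\lambda}(t)}$, a power series in $t$ with constant term $1$ and linear coefficient $1/2$. $[t^m]F(t)$ denotes the coefficient of $t^m$ in the power series $F(t)$; $\frac{t}{\frac{e^t-1}{t}-1}=\frac{t^2}{e^t-1-t}$ is regarded as a power series. -}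

module Defs where

open import Level using (0ℓ)
open import Data.Nat as ℕ using (ℕ; zero; suc; _!; _∸_; _≤?_)
open import Data.Product using (Σ; ∃; _×_; _,_)
open import Data.Sum using (_⊎_)
open import Relation.Nullary using (¬_; yes; no)
open import Relation.Binary.Core using (Rel)
open import Relation.Binary.Structures using (IsStrictTotalOrder)
open import Algebra.Bundles using (CommutativeRing)

-- The real numbers, axiomatised as a complete ordered field.
-- (The standard library has no real numbers; we quantify over every
-- model of the axioms of a complete ordered field.)

record RealField : Set₁ where
  field
    commRing : CommutativeRing 0ℓ 0ℓ
  open CommutativeRing commRing public
  field
    _⁻¹       : Carrier → Carrier
    ⁻¹-cong   : ∀ {x y} → x ≈ y → x ⁻¹ ≈ y ⁻¹
    inverseʳ  : ∀ x → ¬ (x ≈ 0#) → x * (x ⁻¹) ≈ 1#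
    0≉1       : ¬ (0# ≈ 1#)
    _<_       : Rel Carrier 0ℓ
    isStrictTotalOrder : IsStrictTotalOrder _≈_ _<_
    <-+-mono  : ∀ {x y} z → x < y → (x + z) < (y + z)
    <-*-pos   : ∀ {x y} → 0# < x → 0# < y → 0# < (x * y)

  _≤ᵣ_ : Carrier → Carrier → Set
  x ≤ᵣ y = (x < y) ⊎ (x ≈ y)

  field
    lub : (P : Carrier → Set) → ∃ P → (∃ λ b → ∀ x → P x → x ≤ᵣ b) →
          ∃ λ s → (∀ x → P x → x ≤ᵣ s) × (∀ b → (∀ x → P x → x ≤ᵣ b) → s ≤ᵣ b)

-- Formal power series over the reals: PS = ℕ → ℝ, f n = [t^n] f.

module _ (R : RealField) where
  open RealField R

  PS : Set
  PS = ℕ → Carrier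

  nat : ℕ → Carrier
  nat zero    = 0#
  nat (suc n) = 1# + nat n

  sumTo : ℕ → (ℕ → Carrier) → Carrier
  sumTo zero    f = f 0
  sumTo (suc n) f = sumTo n f + f (suc n)

  zeroS : PS
  zeroS _ = 0#

  oneS : PS
  oneS zero    = 1#
  oneS (suc _) = 0#

  X : PS
  X 1 = 1#
  X _ = 0#

  _⊕_ : PS → PS → PS
  (f ⊕ g) n = f n + g n

  _⊖_ : PS → PS → PS
  (f ⊖ g) n = f n - g n

  _·_ : Carrier → PS → PS
  (c · f) n = c * f n

  _⊛_ : PS → PS → PS
  (f ⊛ g) n = sumTo n (λ i → f i * g (n ∸ i))

  _^S_ : PS → ℕ → PS
  f ^S zero    = oneS
  f ^S suc k   = f ⊛ (f ^S k)

  -- composition f(g(t)); meaningful when g 0 = 0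
  _∘S_ : PS → PS → PS
  (f ∘S g) n = sumTo n (λ j → f j * (g ^S j) n)

  deriv : PS → PS
  deriv f n = nat (suc n) * f (suc n)

  -- f(t)/t  (for f with zero constant term)
  divT : PS → PS
  divT f n = f (suc n)

  -- multiplicative inverse 1/f of a series with invertible constant term
  private
    recipPrefix : PS → ℕ → (ℕ → Carrier)
    recipPrefix f zero    _ = (f 0) ⁻¹
    recipPrefix f (suc n) k with k ≤? n
    ... | yes _ = recipPrefix f n k
    ... | no  _ = - ((f 0) ⁻¹ * sumTo n (λ i → f (suc i) * recipPrefix f n (n ∸ i)))

  recip : PS → PS
  recip f n = recipPrefix f n n

  expS : PS
  expS n = (nat (n !)) ⁻¹

  log1pS : PS
  log1pS zero    = 0#
  log1pS (suc m) = sign m * (nat (suc m)) ⁻¹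
    where
    sign : ℕ → Carrier
    sign zero    = 1#
    sign (suc j) = - sign j

  logEλ : Carrier → PS
  logEλ lam = (lam ⁻¹) · (log1pS ∘S (lam · X))

  -- e_λ(t) = (1+λt)^{1/λ} = exp(log e_λ(t))
  eλ : Carrier → PS
  eλ lam = expS ∘S logEλ lam

  eYλ : Carrier → PS
  eYλ lam = (divT (eλ lam ⊖ oneS) ⊛ recip (divT (logEλ lam))) ⊖ oneS

  Dser : PS
  Dser = divT (expS ⊖ oneS) ⊖ oneS

  tOverD : PS
  tOverD = recip (divT Dser)

  -- log_λ(e^t) = (e^{λt} - 1)/λ
  logλExp : Carrier → PS
  logλExp lam = (lam ⁻¹) · ((expS ∘S (lam · X)) ⊖ oneS)

  logλExpOverD : Carrier → PS
  logλExpOverD lam = divT (logλExp lam) ⊛ recip (divT Dser)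

{-# OPTIONS --safe #-}
module Submission where

-- Write ℓ = log e_λ(t), L = log_λ(e^t) and D(t) = (e^t - 1)/t - 1. Then e_{Y,λ} = D ∘ ℓ, and L ∘ ℓ = t
-- because exp (λ ℓ) = 1 + λ t. Hence W = ℓ ∘ ē satisfies D ∘ W = t and ē = L ∘ W = (D ∘ W) (G ∘ W) = t (G ∘ W)
-- with G = L/D, so [t^n] ē^k = [t^(n-k)] (G^k ∘ W). Lagrange inversion for the compositional inverse W of
-- D = t/φ, where φ = t/D, gives (m + 1) [t^(m+1)] H(W) = [t^m] φ^(m+1) H′; take H = G^k. Lagrange inversion
-- itself follows from the chain rule and the residue identity [t^N] φ^(N+1) Q(D) D′ = Q_N, proved by
-- induction on N via Q = Q_0 + t (Q/t).

open import Defs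
open import Algebra.Bundles using (CommutativeRing)
open import Data.Empty using (⊥-elim)
open import Data.Integer as ℤ using (ℤ; +_; -[1+_]; sign; ∣_∣; _◃_)
import Data.Integer.Properties as ℤ
open import Data.Maybe using (Maybe; just; nothing)
open import Data.Nat as ℕ using (ℕ; zero; suc; _∸_; _≤_; z≤n; s≤s; _!)
import Data.Nat.Properties as ℕ
open import Data.Nat.Induction using (<-rec)
open import Data.Product using (_,_)
open import Data.Sign as Sign using (Sign)
open import Data.Sum using (inj₁; inj₂)
open import Level using (0ℓ)
open import Relation.Nullary using (¬_; yes; no)
open import Relation.Binary.Definitions using (tri<; tri≈; tri>)
import Relation.Binary.PropositionalEquality as ≡

-- Integer coefficients make the standard ring solver available in every commutative ring
-- (Tactic.RingSolver would need decidable equality of the carrier).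
module IntegerRingSolver {c ℓ} (CR : CommutativeRing c ℓ) where
  open CommutativeRing CR
  open import Algebra.Properties.Ring ring using (-‿involutive; -0#≈0#; -1*x≈-x)
  open import Algebra.Properties.AbelianGroup +-abelianGroup using (⁻¹-∙-comm)
  open import Algebra.Properties.CommutativeSemigroup +-commutativeSemigroup using () renaming (interchange to +-interchange)
  open import Algebra.Properties.CommutativeSemigroup *-commutativeSemigroup using () renaming (interchange to *-interchange)
  open import Algebra.Properties.Semiring.Mult semiring using (_×_; ×-homo-+; ×1-homo-*)
  import Algebra.Solver.Ring.AlmostCommutativeRing as ACR
  open import Relation.Binary.Reasoning.Setoid setoid

  fromℤ : ℤ → Carrier
  fromℤ (+ n)    = n × 1#
  fromℤ -[1+ n ] = - (suc n × 1#)

  fromSign : Sign → Carrier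
  fromSign Sign.+ = 1#
  fromSign Sign.- = - 1#

  fromSign-homo-* : ∀ s t → fromSign (s Sign.* t) ≈ fromSign s * fromSign t
  fromSign-homo-* Sign.- Sign.- = sym (trans (-1*x≈-x (- 1#)) (-‿involutive 1#))
  fromSign-homo-* Sign.- Sign.+ = sym (*-identityʳ _)
  fromSign-homo-* Sign.+ _      = sym (*-identityˡ _)

  fromℤ-◃ : ∀ s n → fromℤ (s ◃ n) ≈ fromSign s * (n × 1#)
  fromℤ-◃ s      zero    = sym (zeroʳ _)
  fromℤ-◃ Sign.+ (suc n) = sym (*-identityˡ _)
  fromℤ-◃ Sign.- (suc n) = sym (-1*x≈-x _)

  fromℤ-sign-abs : ∀ i → fromℤ i ≈ fromSign (sign i) * (∣ i ∣ × 1#)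
  fromℤ-sign-abs (+ zero)  = sym (zeroʳ _)
  fromℤ-sign-abs (+ suc n) = sym (*-identityˡ _)
  fromℤ-sign-abs -[1+ n ]  = sym (-1*x≈-x _)

  1+x-[1+y]≈x-y : ∀ x y → (1# + x) - (1# + y) ≈ x - y
  1+x-[1+y]≈x-y x y = begin
    (1# + x) - (1# + y)     ≈⟨ +-congˡ (⁻¹-∙-comm 1# y) ⟨
    (1# + x) + (- 1# - y)   ≈⟨ +-interchange 1# x (- 1#) (- y) ⟩
    (1# - 1#) + (x - y)     ≈⟨ +-congʳ (-‿inverseʳ 1#) ⟩
    0# + (x - y)            ≈⟨ +-identityˡ _ ⟩
    x - y                   ∎

  fromℤ-⊖ : ∀ m n → fromℤ (m ℤ.⊖ n) ≈ m × 1# - n × 1#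
  fromℤ-⊖ m zero = begin
    fromℤ (m ℤ.⊖ 0)           ≡⟨ ≡.cong fromℤ (ℤ.⊖-≥ {m} ℕ.z≤n) ⟩
    m × 1#                    ≈⟨ +-identityʳ _ ⟨
    m × 1# + 0#               ≈⟨ +-congˡ -0#≈0# ⟨
    m × 1# - 0#               ∎
  fromℤ-⊖ zero (suc n) = begin
    fromℤ (0 ℤ.⊖ suc n)       ≡⟨ ≡.cong fromℤ (ℤ.⊖-< {0} {suc n} (ℕ.s≤s ℕ.z≤n)) ⟩
    - (suc n × 1#)            ≈⟨ +-identityˡ _ ⟨
    0# - suc n × 1#           ∎
  fromℤ-⊖ (suc m) (suc n) = begin
    fromℤ (suc m ℤ.⊖ suc n)   ≡⟨ ≡.cong fromℤ (ℤ.[1+m]⊖[1+n]≡m⊖n m n) ⟩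
    fromℤ (m ℤ.⊖ n)           ≈⟨ fromℤ-⊖ m n ⟩
    m × 1# - n × 1#           ≈⟨ 1+x-[1+y]≈x-y _ _ ⟨
    suc m × 1# - suc n × 1#   ∎

  fromℤ-homo-+ : ∀ i j → fromℤ (i ℤ.+ j) ≈ fromℤ i + fromℤ j
  fromℤ-homo-+ (+ m)      (+ n)      = ×-homo-+ 1# m n
  fromℤ-homo-+ (+ m)      -[1+ n ]   = fromℤ-⊖ m (suc n)
  fromℤ-homo-+ -[1+ m ]   (+ n)      = trans (fromℤ-⊖ n (suc m)) (+-comm _ _)
  fromℤ-homo-+ -[1+ m ]   -[1+ n ]   = begin
    - (suc (suc (m ℕ.+ n)) × 1#)          ≡⟨ ≡.cong (λ k → - (suc k × 1#)) (ℕ.+-suc m n) ⟨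
    - ((suc m ℕ.+ suc n) × 1#)            ≈⟨ -‿cong (×-homo-+ 1# (suc m) (suc n)) ⟩
    - (suc m × 1# + suc n × 1#)           ≈⟨ ⁻¹-∙-comm _ _ ⟨
    - (suc m × 1#) + - (suc n × 1#)       ∎

  fromℤ-homo-* : ∀ i j → fromℤ (i ℤ.* j) ≈ fromℤ i * fromℤ j
  fromℤ-homo-* i j = begin
    fromℤ ((sign i Sign.* sign j) ◃ (∣ i ∣ ℕ.* ∣ j ∣))
      ≈⟨ fromℤ-◃ (sign i Sign.* sign j) (∣ i ∣ ℕ.* ∣ j ∣) ⟩
    fromSign (sign i Sign.* sign j) * ((∣ i ∣ ℕ.* ∣ j ∣) × 1#)
      ≈⟨ *-cong (fromSign-homo-* (sign i) (sign j)) (×1-homo-* ∣ i ∣ ∣ j ∣) ⟩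
    (fromSign (sign i) * fromSign (sign j)) * ((∣ i ∣ × 1#) * (∣ j ∣ × 1#))
      ≈⟨ *-interchange _ _ _ _ ⟩
    (fromSign (sign i) * (∣ i ∣ × 1#)) * (fromSign (sign j) * (∣ j ∣ × 1#))
      ≈⟨ *-cong (fromℤ-sign-abs i) (fromℤ-sign-abs j) ⟨
    fromℤ i * fromℤ j ∎

  fromℤ-homo-‿ : ∀ i → fromℤ (ℤ.- i) ≈ - fromℤ i
  fromℤ-homo-‿ (+ zero)  = sym -0#≈0#
  fromℤ-homo-‿ (+ suc n) = refl
  fromℤ-homo-‿ -[1+ n ]  = sym (-‿involutive _)

  ℤ⟶CR : ℤ.+-*-rawRing ACR.-Raw-AlmostCommutative⟶ ACR.fromCommutativeRing CR
  ℤ⟶CR = record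
    { ⟦_⟧ = fromℤ ; +-homo = fromℤ-homo-+ ; *-homo = fromℤ-homo-* ; -‿homo = fromℤ-homo-‿
    ; 0-homo = refl ; 1-homo = +-identityʳ 1# }

  fromℤ-≟ : ∀ i j → Maybe (fromℤ i ≈ fromℤ j)
  fromℤ-≟ i j with i ℤ.≟ j
  ... | yes ≡.refl = just refl
  ... | no _       = nothing

  open import Algebra.Solver.Ring ℤ.+-*-rawRing (ACR.fromCommutativeRing CR) ℤ⟶CR fromℤ-≟ public

module RealFieldProperties (R : RealField) where
  open RealField R renaming (_<_ to infix 4 _<_)
  open import Algebra.Properties.Ring ring using (-‿involutive; -1*x≈-x)
  open import Algebra.Properties.Semiring.Mult semiring using (_×_; ×1-homo-*)
  open import Relation.Binary.Structures using (IsStrictTotalOrder)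
  open IsStrictTotalOrder isStrictTotalOrder using (compare; irrefl; <-respʳ-≈; <-respˡ-≈) renaming (trans to <-trans)
  open import Relation.Binary.Reasoning.Setoid setoid

  0<1 : 0# < 1#
  0<1 with compare 0# 1#
  ... | tri< 0<1 _ _ = 0<1
  ... | tri≈ _ 0≈1 _ = ⊥-elim (0≉1 0≈1)
  ... | tri> _ _ 1<0 = ⊥-elim (irrefl refl (<-trans 1<0 (<-respʳ-≈ -1*-1≈1 (<-*-pos 0<-1 0<-1))))
    where
    0<-1 : 0# < - 1#
    0<-1 = <-respˡ-≈ (-‿inverseʳ 1#) (<-respʳ-≈ (+-identityˡ _) (<-+-mono (- 1#) 1<0))
    -1*-1≈1 : - 1# * - 1# ≈ 1#
    -1*-1≈1 = trans (-1*x≈-x (- 1#)) (-‿involutive 1#)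

  0<nat-suc : ∀ n → 0# < nat R (suc n)
  0<nat-suc zero    = <-respʳ-≈ (sym (+-identityʳ _)) 0<1
  0<nat-suc (suc n) = <-trans (<-respʳ-≈ (sym (+-identityˡ _)) (0<nat-suc n)) (<-+-mono (nat R (suc n)) 0<1)

  nat-suc≉0 : ∀ n → ¬ (nat R (suc n) ≈ 0#)
  nat-suc≉0 n n≈0 = irrefl refl (<-respʳ-≈ n≈0 (0<nat-suc n))

  nat≈×1 : ∀ n → nat R n ≈ n × 1#
  nat≈×1 zero    = refl
  nat≈×1 (suc n) = +-congˡ (nat≈×1 n)

  nat-homo-* : ∀ m n → nat R (m ℕ.* n) ≈ nat R m * nat R n
  nat-homo-* m n = begin
    nat R (m ℕ.* n)           ≈⟨ nat≈×1 (m ℕ.* n) ⟩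
    (m ℕ.* n) × 1#            ≈⟨ ×1-homo-* m n ⟩
    (m × 1#) * (n × 1#)       ≈⟨ *-cong (nat≈×1 m) (nat≈×1 n) ⟨
    nat R m * nat R n         ∎

  nat-!≉0 : ∀ n → ¬ (nat R (n !) ≈ 0#)
  nat-!≉0 n with n ! | ℕ.1≤n! n
  ... | suc m | _ = nat-suc≉0 m

  nat-1 : nat R 1 ≈ 1#
  nat-1 = +-identityʳ 1#

  x≈0⇒x*y≈0 : ∀ {x} → x ≈ 0# → ∀ y → x * y ≈ 0#
  x≈0⇒x*y≈0 x≈0 y = trans (*-congʳ x≈0) (zeroˡ y)

  inverseˡ : ∀ x → ¬ (x ≈ 0#) → x ⁻¹ * x ≈ 1#
  inverseˡ x x≉0 = trans (*-comm _ _) (inverseʳ x x≉0)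

  x⁻¹*[x*y]≈y : ∀ {x} y → ¬ (x ≈ 0#) → x ⁻¹ * (x * y) ≈ y
  x⁻¹*[x*y]≈y {x} y x≉0 = begin
    x ⁻¹ * (x * y)   ≈⟨ *-assoc _ _ _ ⟨
    (x ⁻¹ * x) * y   ≈⟨ *-congʳ (inverseˡ x x≉0) ⟩
    1# * y           ≈⟨ *-identityˡ y ⟩
    y                ∎

  x*[x⁻¹*y]≈y : ∀ {x} y → ¬ (x ≈ 0#) → x * (x ⁻¹ * y) ≈ y
  x*[x⁻¹*y]≈y {x} y x≉0 = begin
    x * (x ⁻¹ * y)   ≈⟨ *-assoc _ _ _ ⟨
    (x * x ⁻¹) * y   ≈⟨ *-congʳ (inverseʳ x x≉0) ⟩
    1# * y           ≈⟨ *-identityˡ y ⟩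
    y                ∎

  *-cancelˡ : ∀ {x y z} → ¬ (x ≈ 0#) → x * y ≈ x * z → y ≈ z
  *-cancelˡ {x} {y} {z} x≉0 xy≈xz = begin
    y                ≈⟨ x⁻¹*[x*y]≈y y x≉0 ⟨
    x ⁻¹ * (x * y)   ≈⟨ *-congˡ xy≈xz ⟩
    x ⁻¹ * (x * z)   ≈⟨ x⁻¹*[x*y]≈y z x≉0 ⟩
    z                ∎

  *-≉0 : ∀ {x y} → ¬ (x ≈ 0#) → ¬ (y ≈ 0#) → ¬ (x * y ≈ 0#)
  *-≉0 {x} {y} x≉0 y≉0 xy≈0 = y≉0 (*-cancelˡ x≉0 (trans xy≈0 (sym (zeroʳ x))))

  ⁻¹-≉0 : ∀ {x} → ¬ (x ≈ 0#) → ¬ (x ⁻¹ ≈ 0#)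
  ⁻¹-≉0 {x} x≉0 x⁻¹≈0 = 0≉1 (begin
    0#          ≈⟨ zeroʳ x ⟨
    x * 0#      ≈⟨ *-congˡ x⁻¹≈0 ⟨
    x * x ⁻¹    ≈⟨ inverseʳ x x≉0 ⟩
    1#          ∎)

  ⁻¹-distrib-* : ∀ {x y} → ¬ (x ≈ 0#) → ¬ (y ≈ 0#) → (x * y) ⁻¹ ≈ x ⁻¹ * y ⁻¹
  ⁻¹-distrib-* {x} {y} x≉0 y≉0 = *-cancelˡ (*-≉0 x≉0 y≉0) (begin
    (x * y) * (x * y) ⁻¹          ≈⟨ inverseʳ _ (*-≉0 x≉0 y≉0) ⟩
    1#                            ≈⟨ *-identityˡ 1# ⟨
    1# * 1#                       ≈⟨ *-cong (inverseʳ x x≉0) (inverseʳ y y≉0) ⟨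
    (x * x ⁻¹) * (y * y ⁻¹)       ≈⟨ *-interchange _ _ _ _ ⟩
    (x * y) * (x ⁻¹ * y ⁻¹)       ∎)
    where open import Algebra.Properties.CommutativeSemigroup *-commutativeSemigroup using () renaming (interchange to *-interchange)

  x⁻¹*y≈[z*x]⁻¹*[z*y] : ∀ {x z} y → ¬ (z ≈ 0#) → ¬ (x ≈ 0#) → x ⁻¹ * y ≈ (z * x) ⁻¹ * (z * y)
  x⁻¹*y≈[z*x]⁻¹*[z*y] {x} {z} y z≉0 x≉0 = begin
    x ⁻¹ * y                      ≈⟨ *-congˡ (x⁻¹*[x*y]≈y y z≉0) ⟨
    x ⁻¹ * (z ⁻¹ * (z * y))       ≈⟨ *-assoc _ _ _ ⟨
    (x ⁻¹ * z ⁻¹) * (z * y)       ≈⟨ *-congʳ (trans (*-comm _ _) (sym (⁻¹-distrib-* z≉0 x≉0))) ⟩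
    (z * x) ⁻¹ * (z * y)          ∎

  1⁻¹≈1 : 1# ⁻¹ ≈ 1#
  1⁻¹≈1 = *-cancelˡ (λ 1≈0 → 0≉1 (sym 1≈0)) (trans (inverseʳ 1# (λ 1≈0 → 0≉1 (sym 1≈0))) (sym (*-identityˡ 1#)))

module SumProperties (R : RealField) where
  open RealField R hiding (_<_)
  open import Relation.Binary.Reasoning.Setoid setoid
  open import Data.Nat using (_<_)

  sumTo-congᵇ : ∀ n {f g : ℕ → Carrier} → (∀ i → i ≤ n → f i ≈ g i) → sumTo R n f ≈ sumTo R n g
  sumTo-congᵇ zero    f≈g = f≈g 0 z≤n
  sumTo-congᵇ (suc n) f≈g = +-cong (sumTo-congᵇ n (λ i i≤n → f≈g i (ℕ.m≤n⇒m≤1+n i≤n))) (f≈g (suc n) ℕ.≤-refl)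

  sumTo-cong : ∀ n {f g : ℕ → Carrier} → (∀ i → f i ≈ g i) → sumTo R n f ≈ sumTo R n g
  sumTo-cong n f≈g = sumTo-congᵇ n (λ i _ → f≈g i)

  sumTo-≈0 : ∀ n {f : ℕ → Carrier} → (∀ i → i ≤ n → f i ≈ 0#) → sumTo R n f ≈ 0#
  sumTo-≈0 zero    f≈0 = f≈0 0 z≤n
  sumTo-≈0 (suc n) f≈0 = trans (+-cong (sumTo-≈0 n (λ i i≤n → f≈0 i (ℕ.m≤n⇒m≤1+n i≤n))) (f≈0 (suc n) ℕ.≤-refl)) (+-identityˡ 0#)

  sumTo-distrib-+ : ∀ n (f g : ℕ → Carrier) → sumTo R n (λ i → f i + g i) ≈ sumTo R n f + sumTo R n g
  sumTo-distrib-+ zero    f g = refl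
  sumTo-distrib-+ (suc n) f g = trans (+-congʳ (sumTo-distrib-+ n f g)) (+-interchange _ _ _ _)
    where open import Algebra.Properties.CommutativeSemigroup +-commutativeSemigroup using () renaming (interchange to +-interchange)

  *-distribˡ-sumTo : ∀ n c (f : ℕ → Carrier) → c * sumTo R n f ≈ sumTo R n (λ i → c * f i)
  *-distribˡ-sumTo zero    c f = refl
  *-distribˡ-sumTo (suc n) c f = trans (distribˡ _ _ _) (+-congʳ (*-distribˡ-sumTo n c f))

  -‿distrib-sumTo : ∀ n (f : ℕ → Carrier) → - sumTo R n f ≈ sumTo R n (λ i → - f i)
  -‿distrib-sumTo zero    f = refl
  -‿distrib-sumTo (suc n) f = trans (sym (⁻¹-∙-comm _ _)) (+-congʳ (-‿distrib-sumTo n f))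
    where open import Algebra.Properties.AbelianGroup +-abelianGroup using (⁻¹-∙-comm)

  sumTo-suc-head : ∀ n (f : ℕ → Carrier) → sumTo R (suc n) f ≈ f 0 + sumTo R n (λ i → f (suc i))
  sumTo-suc-head zero    f = refl
  sumTo-suc-head (suc n) f = trans (+-congʳ (sumTo-suc-head n f)) (+-assoc _ _ _)

  sumTo-reverse : ∀ n (f : ℕ → Carrier) → sumTo R n f ≈ sumTo R n (λ i → f (n ∸ i))
  sumTo-reverse zero    f = refl
  sumTo-reverse (suc n) f = begin
    sumTo R n f + f (suc n)                      ≈⟨ +-congʳ (sumTo-reverse n f) ⟩
    sumTo R n (λ i → f (n ∸ i)) + f (suc n)      ≈⟨ +-comm _ _ ⟩
    f (suc n) + sumTo R n (λ i → f (n ∸ i))      ≈⟨ sumTo-suc-head n (λ i → f (suc n ∸ i)) ⟨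
    sumTo R (suc n) (λ i → f (suc n ∸ i))        ∎

  sumTo-comm : ∀ m n (f : ℕ → ℕ → Carrier) →
               sumTo R m (λ i → sumTo R n (f i)) ≈ sumTo R n (λ j → sumTo R m (λ i → f i j))
  sumTo-comm zero    n f = refl
  sumTo-comm (suc m) n f = trans (+-congʳ (sumTo-comm m n f)) (sym (sumTo-distrib-+ n _ _))

  sumTo-extend : ∀ {m} n {f : ℕ → Carrier} → m ≤ n → (∀ i → m < i → i ≤ n → f i ≈ 0#) →
                 sumTo R n f ≈ sumTo R m f
  sumTo-extend zero    z≤n     _   = refl
  sumTo-extend (suc n) m≤1+n f≈0 with ℕ.m≤n⇒m<n∨m≡n m≤1+n
  ... | inj₂ ≡.refl = refl
  ... | inj₁ m<1+n  = trans (+-cong (sumTo-extend n (ℕ.≤-pred m<1+n) (λ i m<i i≤n → f≈0 i m<i (ℕ.m≤n⇒m≤1+n i≤n)))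
                                    (f≈0 (suc n) m<1+n ℕ.≤-refl))
                            (+-identityʳ _)

module FormalPowerSeries (R : RealField) where
  open RealField R hiding (_<_)
  open RealFieldProperties R
  open SumProperties R
  open import Algebra.Properties.Ring ring using (-‿distribˡ-*)
  open import Data.Nat using (_<_)
  open import Relation.Binary.Reasoning.Setoid setoid
  open IntegerRingSolver commRing using (solve; _:=_; _:+_; _:*_; _:-_; :-_)

  infix  4 _≋_
  infixl 6 _⊞_ _⊟_
  infixl 7 _⋆_ _•_
  infixr 8 _^_
  infixr 9 _⊚_

  _≋_ : PS R → PS R → Set
  f ≋ g = ∀ n → f n ≈ g n

  ≋-refl : ∀ {f} → f ≋ f
  ≋-refl n = refl

  ≋-sym : ∀ {f g} → f ≋ g → g ≋ f
  ≋-sym f≋g n = sym (f≋g n)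

  ≋-trans : ∀ {f g h} → f ≋ g → g ≋ h → f ≋ h
  ≋-trans f≋g g≋h n = trans (f≋g n) (g≋h n)

  infixr 2 _≋⟨_⟩_ _≋⟨_⟨_
  infix  3 _∎≋

  _≋⟨_⟩_ : ∀ f {g h} → f ≋ g → g ≋ h → f ≋ h
  f ≋⟨ f≋g ⟩ g≋h = ≋-trans f≋g g≋h

  _≋⟨_⟨_ : ∀ f {g h} → g ≋ f → g ≋ h → f ≋ h
  f ≋⟨ g≋f ⟨ g≋h = ≋-trans (≋-sym g≋f) g≋h

  _∎≋ : ∀ f → f ≋ f
  f ∎≋ = ≋-refl

  _⊞_ _⊟_ : PS R → PS R → PS R
  _⊞_ = _⊕_ R
  _⊟_ = _⊖_ R

  _•_ : Carrier → PS R → PS R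
  _•_ = _·_ R

  negate : PS R → PS R
  negate f n = - f n

  𝟘 𝟙 𝕏 : PS R
  𝟘 = zeroS R
  𝟙 = oneS R
  𝕏 = X R

  const : Carrier → PS R
  const c zero    = c
  const c (suc _) = 0#

  -- Opaque copies of the operations of Defs, so that series can be inferred from coefficients such as (f ⋆ g) n.
  opaque
    _⋆_ : PS R → PS R → PS R
    _⋆_ = _⊛_ R

    ⋆-def : ∀ f g n → (f ⋆ g) n ≈ sumTo R n (λ i → f i * g (n ∸ i))
    ⋆-def f g n = refl

    ⊛≋⋆ : ∀ f g → _⊛_ R f g ≋ f ⋆ g
    ⊛≋⋆ f g n = refl

  opaque
    divX : PS R → PS R
    divX = divT R

    divX-def : ∀ f n → divX f n ≈ f (suc n)
    divX-def f n = refl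

    divT≋divX : ∀ f → divT R f ≋ divX f
    divT≋divX f n = refl

  opaque
    ∂ : PS R → PS R
    ∂ = deriv R

    ∂-def : ∀ f n → ∂ f n ≈ nat R (suc n) * f (suc n)
    ∂-def f n = refl

    deriv≋∂ : ∀ f → deriv R f ≋ ∂ f
    deriv≋∂ f n = refl

  _^_ : PS R → ℕ → PS R
  f ^ zero  = 𝟙
  f ^ suc k = f ⋆ f ^ k

  opaque
    _⊚_ : PS R → PS R → PS R
    (f ⊚ g) n = sumTo R n (λ j → f j * (g ^ j) n)

    ⊚-def : ∀ f g n → (f ⊚ g) n ≈ sumTo R n (λ j → f j * (g ^ j) n)
    ⊚-def f g n = refl

  ⋆-cong : ∀ {f f′ g g′} → f ≋ f′ → g ≋ g′ → f ⋆ g ≋ f′ ⋆ g′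
  ⋆-cong {f} {f′} {g} {g′} f≋f′ g≋g′ n = begin
    (f ⋆ g) n                              ≈⟨ ⋆-def f g n ⟩
    sumTo R n (λ i → f i * g (n ∸ i))      ≈⟨ sumTo-cong n (λ i → *-cong (f≋f′ i) (g≋g′ (n ∸ i))) ⟩
    sumTo R n (λ i → f′ i * g′ (n ∸ i))    ≈⟨ ⋆-def f′ g′ n ⟨
    (f′ ⋆ g′) n                            ∎

  ⋆-comm : ∀ f g → f ⋆ g ≋ g ⋆ f
  ⋆-comm f g n = begin
    (f ⋆ g) n                                       ≈⟨ ⋆-def f g n ⟩
    sumTo R n (λ i → f i * g (n ∸ i))               ≈⟨ sumTo-reverse n _ ⟩
    sumTo R n (λ i → f (n ∸ i) * g (n ∸ (n ∸ i)))   ≈⟨ sumTo-congᵇ n (λ i i≤n → trans (*-comm _ _) (*-congʳ (reflexive (≡.cong g (ℕ.m∸[m∸n]≡n i≤n))))) ⟩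
    sumTo R n (λ i → g i * f (n ∸ i))               ≈⟨ ⋆-def g f n ⟨
    (g ⋆ f) n                                       ∎

  ⋆-distribʳ : ∀ f g h → (f ⊞ g) ⋆ h ≋ f ⋆ h ⊞ g ⋆ h
  ⋆-distribʳ f g h n = begin
    ((f ⊞ g) ⋆ h) n                                                     ≈⟨ ⋆-def _ _ n ⟩
    sumTo R n (λ i → (f i + g i) * h (n ∸ i))                           ≈⟨ sumTo-cong n (λ i → distribʳ _ _ _) ⟩
    sumTo R n (λ i → f i * h (n ∸ i) + g i * h (n ∸ i))                 ≈⟨ sumTo-distrib-+ n _ _ ⟩
    sumTo R n (λ i → f i * h (n ∸ i)) + sumTo R n (λ i → g i * h (n ∸ i)) ≈⟨ +-cong (⋆-def f h n) (⋆-def g h n) ⟨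
    (f ⋆ h ⊞ g ⋆ h) n                                                   ∎

  ⋆-distribˡ : ∀ f g h → f ⋆ (g ⊞ h) ≋ f ⋆ g ⊞ f ⋆ h
  ⋆-distribˡ f g h = ≋-trans (⋆-comm f _) (≋-trans (⋆-distribʳ g h f) (λ n → +-cong (⋆-comm g f n) (⋆-comm h f n)))

  ⋆-coeff-0 : ∀ f g → (f ⋆ g) 0 ≈ f 0 * g 0
  ⋆-coeff-0 f g = ⋆-def f g 0

  ⋆-coeff-suc : ∀ f g n → (f ⋆ g) (suc n) ≈ f 0 * g (suc n) + (divX f ⋆ g) n
  ⋆-coeff-suc f g n = begin
    (f ⋆ g) (suc n)                                                    ≈⟨ ⋆-def f g (suc n) ⟩
    sumTo R (suc n) (λ i → f i * g (suc n ∸ i))                        ≈⟨ sumTo-suc-head n _ ⟩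
    f 0 * g (suc n) + sumTo R n (λ i → f (suc i) * g (n ∸ i))           ≈⟨ +-congˡ (sumTo-cong n (λ i → *-congʳ (divX-def f i))) ⟨
    f 0 * g (suc n) + sumTo R n (λ i → divX f i * g (n ∸ i))            ≈⟨ +-congˡ (⋆-def (divX f) g n) ⟨
    f 0 * g (suc n) + (divX f ⋆ g) n                                   ∎

  •-⋆-assoc : ∀ c f g → (c • f) ⋆ g ≋ c • (f ⋆ g)
  •-⋆-assoc c f g n = begin
    ((c • f) ⋆ g) n                             ≈⟨ ⋆-def _ _ n ⟩
    sumTo R n (λ i → (c * f i) * g (n ∸ i))     ≈⟨ sumTo-cong n (λ i → *-assoc _ _ _) ⟩
    sumTo R n (λ i → c * (f i * g (n ∸ i)))     ≈⟨ *-distribˡ-sumTo n c _ ⟨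
    c * sumTo R n (λ i → f i * g (n ∸ i))       ≈⟨ *-congˡ (⋆-def f g n) ⟨
    (c • (f ⋆ g)) n                             ∎

  ⋆-identityˡ : ∀ f → 𝟙 ⋆ f ≋ f
  ⋆-identityˡ f zero    = trans (⋆-coeff-0 𝟙 f) (*-identityˡ _)
  ⋆-identityˡ f (suc n) = begin
    (𝟙 ⋆ f) (suc n)                       ≈⟨ ⋆-coeff-suc 𝟙 f n ⟩
    1# * f (suc n) + (divX 𝟙 ⋆ f) n       ≈⟨ +-cong (*-identityˡ _) (trans (⋆-def (divX 𝟙) f n) (sumTo-≈0 n (λ i _ → trans (*-congʳ (divX-def 𝟙 i)) (zeroˡ _)))) ⟩
    f (suc n) + 0#                        ≈⟨ +-identityʳ _ ⟩
    f (suc n)                             ∎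

  ⋆-identityʳ : ∀ f → f ⋆ 𝟙 ≋ f
  ⋆-identityʳ f = ≋-trans (⋆-comm f 𝟙) (⋆-identityˡ f)

  divX-⋆ : ∀ f g → divX (f ⋆ g) ≋ f 0 • divX g ⊞ divX f ⋆ g
  divX-⋆ f g n = trans (divX-def _ n) (trans (⋆-coeff-suc f g n) (+-congʳ (*-congˡ (sym (divX-def g n)))))

  ⋆-assoc : ∀ f g h → (f ⋆ g) ⋆ h ≋ f ⋆ (g ⋆ h)
  ⋆-assoc f g h zero = begin
    ((f ⋆ g) ⋆ h) 0        ≈⟨ trans (⋆-coeff-0 _ h) (*-congʳ (⋆-coeff-0 f g)) ⟩
    (f 0 * g 0) * h 0      ≈⟨ *-assoc _ _ _ ⟩
    f 0 * (g 0 * h 0)      ≈⟨ trans (⋆-coeff-0 f _) (*-congˡ (⋆-coeff-0 g h)) ⟨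
    (f ⋆ (g ⋆ h)) 0        ∎
  ⋆-assoc f g h (suc n) = begin
    ((f ⋆ g) ⋆ h) (suc n)
      ≈⟨ ⋆-coeff-suc (f ⋆ g) h n ⟩
    (f ⋆ g) 0 * h (suc n) + (divX (f ⋆ g) ⋆ h) n
      ≈⟨ +-cong (*-congʳ (⋆-coeff-0 f g)) (⋆-cong (divX-⋆ f g) ≋-refl n) ⟩
    (f 0 * g 0) * h (suc n) + ((f 0 • divX g ⊞ divX f ⋆ g) ⋆ h) n
      ≈⟨ +-congˡ (trans (⋆-distribʳ _ _ h n) (+-cong (•-⋆-assoc (f 0) (divX g) h n) (⋆-assoc (divX f) g h n))) ⟩
    (f 0 * g 0) * h (suc n) + (f 0 * (divX g ⋆ h) n + (divX f ⋆ (g ⋆ h)) n)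
      ≈⟨ solve 5 (λ a b c d e → (a :* b) :* c :+ (a :* d :+ e) := a :* (b :* c :+ d) :+ e) refl (f 0) (g 0) (h (suc n)) _ _ ⟩
    f 0 * (g 0 * h (suc n) + (divX g ⋆ h) n) + (divX f ⋆ (g ⋆ h)) n
      ≈⟨ +-congʳ (*-congˡ (⋆-coeff-suc g h n)) ⟨
    f 0 * (g ⋆ h) (suc n) + (divX f ⋆ (g ⋆ h)) n
      ≈⟨ ⋆-coeff-suc f (g ⋆ h) n ⟨
    (f ⋆ (g ⋆ h)) (suc n) ∎

  series-commutativeRing : CommutativeRing 0ℓ 0ℓ
  series-commutativeRing = record
    { Carrier = PS R ; _≈_ = _≋_ ; _+_ = _⊞_ ; _*_ = _⋆_ ; -_ = negate ; 0# = 𝟘 ; 1# = 𝟙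
    ; isCommutativeRing = record
      { isRing = record
        { +-isAbelianGroup = record
          { isGroup = record
            { isMonoid = record
              { isSemigroup = record
                { isMagma = record
                  { isEquivalence = record { refl = ≋-refl ; sym = ≋-sym ; trans = ≋-trans }
                  ; ∙-cong = λ f≋f′ g≋g′ n → +-cong (f≋f′ n) (g≋g′ n) }
                ; assoc = λ f g h n → +-assoc _ _ _ }
              ; identity = (λ f n → +-identityˡ _) , (λ f n → +-identityʳ _) }
            ; inverse = (λ f n → -‿inverseˡ _) , (λ f n → -‿inverseʳ _)
            ; ⁻¹-cong = λ f≋g n → -‿cong (f≋g n) }
          ; comm = λ f g n → +-comm _ _ }
        ; *-cong = ⋆-cong
        ; *-assoc = ⋆-assoc
        ; *-identity = ⋆-identityˡ , ⋆-identityʳ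
        ; distrib = ⋆-distribˡ , (λ h f g → ⋆-distribʳ f g h) }
      ; *-comm = ⋆-comm } }

  open IntegerRingSolver series-commutativeRing public using ()
    renaming (solve to solveS; _:=_ to infix 4 _≔_; _:+_ to infixl 7 _⊹_; _:*_ to infixl 8 _⊗_;
              _:-_ to infixl 7 _⊝_; :-_ to infix 9 ⊝_)

  divX-𝕏 : divX 𝕏 ≋ 𝟙
  divX-𝕏 zero    = divX-def 𝕏 0
  divX-𝕏 (suc n) = divX-def 𝕏 (suc n)

  ⋆-zeroʳ : ∀ f → f ⋆ 𝟘 ≋ 𝟘
  ⋆-zeroʳ f n = trans (⋆-def f 𝟘 n) (sumTo-≈0 n (λ i _ → zeroʳ _))

  𝕏⋆-coeff-0 : ∀ f → (𝕏 ⋆ f) 0 ≈ 0#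
  𝕏⋆-coeff-0 f = trans (⋆-coeff-0 𝕏 f) (zeroˡ _)

  𝕏⋆-coeff-suc : ∀ f n → (𝕏 ⋆ f) (suc n) ≈ f n
  𝕏⋆-coeff-suc f n = begin
    (𝕏 ⋆ f) (suc n)                   ≈⟨ ⋆-coeff-suc 𝕏 f n ⟩
    0# * f (suc n) + (divX 𝕏 ⋆ f) n   ≈⟨ +-cong (zeroˡ _) (⋆-cong divX-𝕏 ≋-refl n) ⟩
    0# + (𝟙 ⋆ f) n                    ≈⟨ +-identityˡ _ ⟩
    (𝟙 ⋆ f) n                         ≈⟨ ⋆-identityˡ f n ⟩
    f n                               ∎

  divX-cong : ∀ {f g} → f ≋ g → divX f ≋ divX g
  divX-cong {f} {g} f≋g n = trans (divX-def f n) (trans (f≋g (suc n)) (sym (divX-def g n)))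

  split-𝕏 : ∀ f → f ≋ const (f 0) ⊞ 𝕏 ⋆ divX f
  split-𝕏 f zero    = sym (trans (+-congˡ (𝕏⋆-coeff-0 (divX f))) (+-identityʳ _))
  split-𝕏 f (suc n) = sym (trans (+-congˡ (𝕏⋆-coeff-suc (divX f) n)) (trans (+-identityˡ _) (divX-def f n)))

  const-cong : ∀ {a b} → a ≈ b → const a ≋ const b
  const-cong a≈b zero    = a≈b
  const-cong a≈b (suc n) = refl

  const-0 : const 0# ≋ 𝟘
  const-0 zero    = refl
  const-0 (suc n) = refl

  const-1 : const 1# ≋ 𝟙
  const-1 zero    = refl
  const-1 (suc n) = refl

  split-𝕏₀ : ∀ f → f 0 ≈ 0# → f ≋ 𝕏 ⋆ divX f
  split-𝕏₀ f f₀≈0 n = trans (split-𝕏 f n) (trans (+-congʳ (≋-trans (const-cong f₀≈0) const-0 n)) (+-identityˡ _))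

  const-⋆ : ∀ a f → const a ⋆ f ≋ a • f
  const-⋆ a f zero    = ⋆-coeff-0 (const a) f
  const-⋆ a f (suc n) = begin
    (const a ⋆ f) (suc n)                   ≈⟨ ⋆-coeff-suc (const a) f n ⟩
    a * f (suc n) + (divX (const a) ⋆ f) n  ≈⟨ +-congˡ (trans (⋆-def _ f n) (sumTo-≈0 n (λ i _ → trans (*-congʳ (divX-def (const a) i)) (zeroˡ _)))) ⟩
    a * f (suc n) + 0#                      ≈⟨ +-identityʳ _ ⟩
    a * f (suc n)                           ∎

  const-* : ∀ a b → const (a * b) ≋ const a ⋆ const b
  const-* a b zero    = sym (⋆-coeff-0 (const a) (const b))
  const-* a b (suc n) = trans (sym (zeroʳ a)) (sym (const-⋆ a (const b) (suc n)))

  •-cong : ∀ {a b f g} → a ≈ b → f ≋ g → a • f ≋ b • g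
  •-cong a≈b f≋g n = *-cong a≈b (f≋g n)

  ^-cong : ∀ {f g} k → f ≋ g → f ^ k ≋ g ^ k
  ^-cong zero    f≋g = ≋-refl
  ^-cong (suc k) f≋g = ⋆-cong f≋g (^-cong k f≋g)

  ^-distrib-⋆ : ∀ f g k → (f ⋆ g) ^ k ≋ f ^ k ⋆ g ^ k
  ^-distrib-⋆ f g zero    = ≋-sym (⋆-identityˡ 𝟙)
  ^-distrib-⋆ f g (suc k) = ≋-trans (⋆-cong ≋-refl (^-distrib-⋆ f g k))
    (solveS 4 (λ a b c d → (a ⊗ b) ⊗ (c ⊗ d) ≔ (a ⊗ c) ⊗ (b ⊗ d)) ≋-refl f g (f ^ k) (g ^ k))

  𝕏^⋆-coeff : ∀ k m f → (𝕏 ^ k ⋆ f) (k ℕ.+ m) ≈ f m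
  𝕏^⋆-coeff zero    m f = ⋆-identityˡ f m
  𝕏^⋆-coeff (suc k) m f = begin
    ((𝕏 ⋆ 𝕏 ^ k) ⋆ f) (suc (k ℕ.+ m))   ≈⟨ ⋆-assoc 𝕏 (𝕏 ^ k) f _ ⟩
    (𝕏 ⋆ (𝕏 ^ k ⋆ f)) (suc (k ℕ.+ m))   ≈⟨ 𝕏⋆-coeff-suc _ (k ℕ.+ m) ⟩
    (𝕏 ^ k ⋆ f) (k ℕ.+ m)               ≈⟨ 𝕏^⋆-coeff k m f ⟩
    f m                                 ∎

  ⋆-cong-upto : ∀ {f f′ g g′} n → (∀ i → i ≤ n → f i ≈ f′ i) → (∀ i → i ≤ n → g i ≈ g′ i) → (f ⋆ g) n ≈ (f′ ⋆ g′) n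
  ⋆-cong-upto {f} {f′} {g} {g′} n f≈f′ g≈g′ = begin
    (f ⋆ g) n                              ≈⟨ ⋆-def f g n ⟩
    sumTo R n (λ i → f i * g (n ∸ i))      ≈⟨ sumTo-congᵇ n (λ i i≤n → *-cong (f≈f′ i i≤n) (g≈g′ (n ∸ i) (ℕ.m∸n≤m n i))) ⟩
    sumTo R n (λ i → f′ i * g′ (n ∸ i))    ≈⟨ ⋆-def f′ g′ n ⟨
    (f′ ⋆ g′) n                            ∎

  ⋆-congʳ-below : ∀ g {f f′} n → g 0 ≈ 0# → (∀ i → i < n → f i ≈ f′ i) → (g ⋆ f) n ≈ (g ⋆ f′) n
  ⋆-congʳ-below g {f} {f′} zero    g₀≈0 _    = begin
    (g ⋆ f) 0       ≈⟨ ⋆-coeff-0 g f ⟩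
    g 0 * f 0       ≈⟨ x≈0⇒x*y≈0 g₀≈0 (f 0) ⟩
    0#              ≈⟨ x≈0⇒x*y≈0 g₀≈0 (f′ 0) ⟨
    g 0 * f′ 0      ≈⟨ ⋆-coeff-0 g f′ ⟨
    (g ⋆ f′) 0      ∎
  ⋆-congʳ-below g {f} {f′} (suc n) g₀≈0 f≈f′ = begin
    (g ⋆ f) (suc n)                     ≈⟨ ⋆-coeff-suc g f n ⟩
    g 0 * f (suc n) + (divX g ⋆ f) n    ≈⟨ +-cong (x≈0⇒x*y≈0 g₀≈0 _) (⋆-cong-upto n (λ _ _ → refl) (λ i i≤n → f≈f′ i (s≤s i≤n))) ⟩
    0# + (divX g ⋆ f′) n                ≈⟨ +-congʳ (x≈0⇒x*y≈0 g₀≈0 _) ⟨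
    g 0 * f′ (suc n) + (divX g ⋆ f′) n  ≈⟨ ⋆-coeff-suc g f′ n ⟨
    (g ⋆ f′) (suc n)                    ∎

  ^-cong-upto : ∀ {f f′} n → (∀ i → i ≤ n → f i ≈ f′ i) → ∀ k i → i ≤ n → (f ^ k) i ≈ (f′ ^ k) i
  ^-cong-upto n f≈f′ zero    i i≤n = refl
  ^-cong-upto n f≈f′ (suc k) i i≤n = ⋆-cong-upto i (λ j j≤i → f≈f′ j (ℕ.≤-trans j≤i i≤n))
                                                   (λ j j≤i → ^-cong-upto n f≈f′ k j (ℕ.≤-trans j≤i i≤n))

  ^-coeff-below : ∀ g → g 0 ≈ 0# → ∀ j n → n < j → (g ^ j) n ≈ 0#
  ^-coeff-below g g₀≈0 (suc j) n n<1+j = begin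
    (g ⋆ g ^ j) n              ≈⟨ ⋆-congʳ-below g n g₀≈0 (λ i i<n → ^-coeff-below g g₀≈0 j i (ℕ.<-≤-trans i<n (ℕ.≤-pred n<1+j))) ⟩
    (g ⋆ 𝟘) n                  ≈⟨ ⋆-zeroʳ g n ⟩
    0#                         ∎

  -- As g 0 ≈ 0#, coefficient n of g ⋆ F (divX f) only involves coefficients of F (divX f) below n.
  divX-recursion-unique : ∀ g (A F G : PS R → PS R) → g 0 ≈ 0# →
                          (∀ f → F f ≋ A f ⊞ g ⋆ F (divX f)) → (∀ f → G f ≋ A f ⊞ g ⋆ G (divX f)) →
                          ∀ f → F f ≋ G f
  divX-recursion-unique g A F G g₀≈0 F-rec G-rec f n = <-rec (λ n → ∀ f → F f n ≈ G f n) step n f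
    where
    step : ∀ n → (∀ {m} → m < n → ∀ f → F f m ≈ G f m) → ∀ f → F f n ≈ G f n
    step n ih f = trans (F-rec f n)
      (trans (+-congˡ (⋆-congʳ-below g n g₀≈0 (λ _ m<n → ih m<n (divX f)))) (sym (G-rec f n)))

  ∂-cong : ∀ {f g} → f ≋ g → ∂ f ≋ ∂ g
  ∂-cong {f} {g} f≋g n = trans (∂-def f n) (trans (*-congˡ (f≋g (suc n))) (sym (∂-def g n)))

  ∂-⊞ : ∀ f g → ∂ (f ⊞ g) ≋ ∂ f ⊞ ∂ g
  ∂-⊞ f g n = trans (∂-def _ n) (trans (distribˡ _ _ _) (sym (+-cong (∂-def f n) (∂-def g n))))

  ∂-• : ∀ c f → ∂ (c • f) ≋ c • ∂ f
  ∂-• c f n = trans (∂-def _ n) (trans (x∙yz≈y∙xz _ _ _) (*-congˡ (sym (∂-def f n))))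
    where open import Algebra.Properties.CommutativeSemigroup *-commutativeSemigroup using (x∙yz≈y∙xz)

  ∂-const : ∀ c → ∂ (const c) ≋ 𝟘
  ∂-const c n = trans (∂-def _ n) (zeroʳ _)

  ∂-𝟙 : ∂ 𝟙 ≋ 𝟘
  ∂-𝟙 n = trans (∂-def _ n) (zeroʳ _)

  ∂-𝕏 : ∂ 𝕏 ≋ 𝟙
  ∂-𝕏 zero    = trans (∂-def _ 0) (trans (*-identityʳ _) nat-1)
  ∂-𝕏 (suc n) = trans (∂-def _ (suc n)) (zeroʳ _)

  ∂-𝕏⋆ : ∀ f → ∂ (𝕏 ⋆ f) ≋ f ⊞ 𝕏 ⋆ ∂ f
  ∂-𝕏⋆ f zero = begin
    ∂ (𝕏 ⋆ f) 0                ≈⟨ trans (∂-def _ 0) (*-congˡ (𝕏⋆-coeff-suc f 0)) ⟩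
    nat R 1 * f 0              ≈⟨ trans (*-congʳ nat-1) (*-identityˡ _) ⟩
    f 0                        ≈⟨ +-identityʳ _ ⟨
    f 0 + 0#                   ≈⟨ +-congˡ (𝕏⋆-coeff-0 _) ⟨
    f 0 + (𝕏 ⋆ ∂ f) 0          ∎
  ∂-𝕏⋆ f (suc n) = begin
    ∂ (𝕏 ⋆ f) (suc n)                            ≈⟨ trans (∂-def _ (suc n)) (*-congˡ (𝕏⋆-coeff-suc f (suc n))) ⟩
    (1# + nat R (suc n)) * f (suc n)             ≈⟨ distribʳ _ _ _ ⟩
    1# * f (suc n) + nat R (suc n) * f (suc n)   ≈⟨ +-cong (*-identityˡ _) (sym (∂-def f n)) ⟩
    f (suc n) + ∂ f n                            ≈⟨ +-congˡ (𝕏⋆-coeff-suc (∂ f) n) ⟨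
    f (suc n) + (𝕏 ⋆ ∂ f) (suc n)                ∎

  ∂-split-𝕏 : ∀ f → ∂ f ≋ divX f ⊞ 𝕏 ⋆ ∂ (divX f)
  ∂-split-𝕏 f =
    ∂ f                                          ≋⟨ ∂-cong (split-𝕏 f) ⟩
    ∂ (const (f 0) ⊞ 𝕏 ⋆ divX f)                 ≋⟨ ∂-⊞ _ _ ⟩
    ∂ (const (f 0)) ⊞ ∂ (𝕏 ⋆ divX f)             ≋⟨ (λ n → trans (+-cong (∂-const (f 0) n) (∂-𝕏⋆ (divX f) n)) (+-identityˡ _)) ⟩
    divX f ⊞ 𝕏 ⋆ ∂ (divX f)                      ∎≋

  ∂-⋆ : ∀ f g → ∂ (f ⋆ g) ≋ ∂ f ⋆ g ⊞ f ⋆ ∂ g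
  ∂-⋆ f g = divX-recursion-unique 𝕏 A (λ f → ∂ (f ⋆ g)) (λ f → ∂ f ⋆ g ⊞ f ⋆ ∂ g) refl lhs-rec rhs-rec f
    where
    A : PS R → PS R
    A f = const (f 0) ⋆ ∂ g ⊞ divX f ⋆ g
    lhs-rec : ∀ f → ∂ (f ⋆ g) ≋ A f ⊞ 𝕏 ⋆ ∂ (divX f ⋆ g)
    lhs-rec f =
      ∂ (f ⋆ g)
        ≋⟨ ∂-cong (⋆-cong (split-𝕏 f) ≋-refl) ⟩
      ∂ ((const (f 0) ⊞ 𝕏 ⋆ divX f) ⋆ g)
        ≋⟨ ∂-cong (solveS 4 (λ c x f′ g → (c ⊹ x ⊗ f′) ⊗ g ≔ c ⊗ g ⊹ x ⊗ (f′ ⊗ g)) ≋-refl (const (f 0)) 𝕏 (divX f) g) ⟩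
      ∂ (const (f 0) ⋆ g ⊞ 𝕏 ⋆ (divX f ⋆ g))
        ≋⟨ ∂-⊞ _ _ ⟩
      ∂ (const (f 0) ⋆ g) ⊞ ∂ (𝕏 ⋆ (divX f ⋆ g))
        ≋⟨ (λ n → +-cong (∂-const⋆ n) (∂-𝕏⋆ _ n)) ⟩
      const (f 0) ⋆ ∂ g ⊞ (divX f ⋆ g ⊞ 𝕏 ⋆ ∂ (divX f ⋆ g))
        ≋⟨ (λ n → sym (+-assoc _ _ _)) ⟩
      A f ⊞ 𝕏 ⋆ ∂ (divX f ⋆ g) ∎≋
      where
      ∂-const⋆ : ∂ (const (f 0) ⋆ g) ≋ const (f 0) ⋆ ∂ g
      ∂-const⋆ = ≋-trans (∂-cong (const-⋆ (f 0) g)) (≋-trans (∂-• (f 0) g) (≋-sym (const-⋆ (f 0) (∂ g))))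
    rhs-rec : ∀ f → ∂ f ⋆ g ⊞ f ⋆ ∂ g ≋ A f ⊞ 𝕏 ⋆ (∂ (divX f) ⋆ g ⊞ divX f ⋆ ∂ g)
    rhs-rec f =
      ∂ f ⋆ g ⊞ f ⋆ ∂ g
        ≋⟨ (λ n → +-cong (⋆-cong (∂-split-𝕏 f) ≋-refl n) (⋆-cong (split-𝕏 f) ≋-refl n)) ⟩
      (divX f ⊞ 𝕏 ⋆ ∂ (divX f)) ⋆ g ⊞ (const (f 0) ⊞ 𝕏 ⋆ divX f) ⋆ ∂ g
        ≋⟨ solveS 6 (λ c x f′ g df′ dg → (f′ ⊹ x ⊗ df′) ⊗ g ⊹ (c ⊹ x ⊗ f′) ⊗ dg ≔ (c ⊗ dg ⊹ f′ ⊗ g) ⊹ x ⊗ (df′ ⊗ g ⊹ f′ ⊗ dg))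
                  ≋-refl (const (f 0)) 𝕏 (divX f) g (∂ (divX f)) (∂ g) ⟩
      A f ⊞ 𝕏 ⋆ (∂ (divX f) ⋆ g ⊞ divX f ⋆ ∂ g) ∎≋

  ⋆-•-comm : ∀ c f g → f ⋆ (c • g) ≋ c • (f ⋆ g)
  ⋆-•-comm c f g = ≋-trans (⋆-comm f _) (≋-trans (•-⋆-assoc c g f) (•-cong refl (⋆-comm g f)))

  ∂-^ : ∀ f k → ∂ (f ^ suc k) ≋ nat R (suc k) • (f ^ k ⋆ ∂ f)
  ∂-^ f zero n = begin
    ∂ (f ⋆ 𝟙) n             ≈⟨ ∂-cong (⋆-identityʳ f) n ⟩
    ∂ f n                   ≈⟨ ⋆-identityˡ (∂ f) n ⟨
    (𝟙 ⋆ ∂ f) n             ≈⟨ *-identityˡ _ ⟨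
    1# * (𝟙 ⋆ ∂ f) n        ≈⟨ *-congʳ nat-1 ⟨
    nat R 1 * (𝟙 ⋆ ∂ f) n   ∎
  ∂-^ f (suc k) n = begin
    ∂ (f ⋆ f ^ suc k) n                                     ≈⟨ ∂-⋆ f (f ^ suc k) n ⟩
    (∂ f ⋆ f ^ suc k) n + (f ⋆ ∂ (f ^ suc k)) n             ≈⟨ +-cong (⋆-comm _ _ n) (⋆-cong ≋-refl (∂-^ f k) n) ⟩
    A n + (f ⋆ (nat R (suc k) • (f ^ k ⋆ ∂ f))) n            ≈⟨ +-congˡ (trans (⋆-•-comm _ f _ n) (*-congˡ (≋-sym (⋆-assoc f (f ^ k) (∂ f)) n))) ⟩
    A n + nat R (suc k) * A n                                ≈⟨ +-congʳ (*-identityˡ _) ⟨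
    1# * A n + nat R (suc k) * A n                           ≈⟨ distribʳ _ _ _ ⟨
    nat R (suc (suc k)) * A n                                ∎
    where A = f ^ suc k ⋆ ∂ f

  ⊚-coeff-0 : ∀ f g → (f ⊚ g) 0 ≈ f 0
  ⊚-coeff-0 f g = trans (⊚-def f g 0) (*-identityʳ _)

  ⊚-congˡ : ∀ {f f′} g → f ≋ f′ → f ⊚ g ≋ f′ ⊚ g
  ⊚-congˡ {f} {f′} g f≋f′ n = trans (⊚-def f g n) (trans (sumTo-cong n (λ j → *-congʳ (f≋f′ j))) (sym (⊚-def f′ g n)))

  ⊚-congʳ : ∀ f {g g′} → g ≋ g′ → f ⊚ g ≋ f ⊚ g′
  ⊚-congʳ f {g} {g′} g≋g′ n = trans (⊚-def f g n) (trans (sumTo-cong n (λ j → *-congˡ (^-cong j g≋g′ n))) (sym (⊚-def f g′ n)))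

  ⊚-congʳ-upto : ∀ f {g g′} n → (∀ i → i ≤ n → g i ≈ g′ i) → (f ⊚ g) n ≈ (f ⊚ g′) n
  ⊚-congʳ-upto f {g} {g′} n g≈g′ = trans (⊚-def f g n)
    (trans (sumTo-cong n (λ j → *-congˡ (^-cong-upto n g≈g′ j n ℕ.≤-refl))) (sym (⊚-def f g′ n)))

  ⊚-extend : ∀ f g → g 0 ≈ 0# → ∀ {n} m → n ≤ m → (f ⊚ g) n ≈ sumTo R m (λ j → f j * (g ^ j) n)
  ⊚-extend f g g₀≈0 {n} m n≤m = trans (⊚-def f g n)
    (sym (sumTo-extend m n≤m (λ j n<j _ → trans (*-congˡ (^-coeff-below g g₀≈0 j n n<j)) (zeroʳ _))))

  ⊚-horner : ∀ f g → g 0 ≈ 0# → f ⊚ g ≋ const (f 0) ⊞ g ⋆ (divX f ⊚ g)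
  ⊚-horner f g g₀≈0 n = begin
    (f ⊚ g) n                                                   ≈⟨ ⊚-extend f g g₀≈0 (suc n) (ℕ.n≤1+n n) ⟩
    sumTo R (suc n) (λ j → f j * (g ^ j) n)                     ≈⟨ sumTo-suc-head n _ ⟩
    f 0 * 𝟙 n + sumTo R n (λ j → f (suc j) * (g ⋆ g ^ j) n)     ≈⟨ +-cong (f₀*𝟙≈const n) (sym tail) ⟩
    const (f 0) n + (g ⋆ (divX f ⊚ g)) n                        ∎
    where
    f₀*𝟙≈const : ∀ n → f 0 * 𝟙 n ≈ const (f 0) n
    f₀*𝟙≈const zero    = *-identityʳ _
    f₀*𝟙≈const (suc n) = zeroʳ _
    tail : (g ⋆ (divX f ⊚ g)) n ≈ sumTo R n (λ j → f (suc j) * (g ⋆ g ^ j) n)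
    tail = begin
      (g ⋆ (divX f ⊚ g)) n
        ≈⟨ ⋆-def _ _ n ⟩
      sumTo R n (λ i → g i * (divX f ⊚ g) (n ∸ i))
        ≈⟨ sumTo-congᵇ n (λ i _ → *-congˡ (⊚-extend (divX f) g g₀≈0 n (ℕ.m∸n≤m n i))) ⟩
      sumTo R n (λ i → g i * sumTo R n (λ j → divX f j * (g ^ j) (n ∸ i)))
        ≈⟨ sumTo-cong n (λ i → *-distribˡ-sumTo n _ _) ⟩
      sumTo R n (λ i → sumTo R n (λ j → g i * (divX f j * (g ^ j) (n ∸ i))))
        ≈⟨ sumTo-comm n n _ ⟩
      sumTo R n (λ j → sumTo R n (λ i → g i * (divX f j * (g ^ j) (n ∸ i))))
        ≈⟨ sumTo-cong n (λ j → sumTo-cong n (λ i → trans (x∙yz≈y∙xz _ _ _) (*-congʳ (divX-def f j)))) ⟩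
      sumTo R n (λ j → sumTo R n (λ i → f (suc j) * (g i * (g ^ j) (n ∸ i))))
        ≈⟨ sumTo-cong n (λ j → trans (sym (*-distribˡ-sumTo n _ _)) (*-congˡ (sym (⋆-def g (g ^ j) n)))) ⟩
      sumTo R n (λ j → f (suc j) * (g ⋆ g ^ j) n) ∎
      where open import Algebra.Properties.CommutativeSemigroup *-commutativeSemigroup using (x∙yz≈y∙xz)

  ⊚-⊞ : ∀ f h g → (f ⊞ h) ⊚ g ≋ f ⊚ g ⊞ h ⊚ g
  ⊚-⊞ f h g n = trans (⊚-def _ g n)
    (trans (trans (sumTo-cong n (λ j → distribʳ _ _ _)) (sumTo-distrib-+ n _ _)) (sym (+-cong (⊚-def f g n) (⊚-def h g n))))

  ⊚-• : ∀ c f g → (c • f) ⊚ g ≋ c • (f ⊚ g)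
  ⊚-• c f g n = trans (⊚-def _ g n)
    (trans (trans (sumTo-cong n (λ j → *-assoc _ _ _)) (sym (*-distribˡ-sumTo n c _))) (*-congˡ (sym (⊚-def f g n))))

  ⊚-⊟ : ∀ f h g → (f ⊟ h) ⊚ g ≋ f ⊚ g ⊟ h ⊚ g
  ⊚-⊟ f h g n = trans (⊚-⊞ f (negate h) g n) (+-congˡ ⊚-negate)
    where
    ⊚-negate : (negate h ⊚ g) n ≈ - (h ⊚ g) n
    ⊚-negate = trans (⊚-def _ g n)
      (trans (trans (sumTo-cong n (λ j → sym (-‿distribˡ-* _ _))) (sym (-‿distrib-sumTo n _))) (-‿cong (sym (⊚-def h g n))))

  ⊚-const : ∀ c g → const c ⊚ g ≋ const c
  ⊚-const c g zero    = ⊚-coeff-0 _ g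
  ⊚-const c g (suc n) = begin
    (const c ⊚ g) (suc n)                                              ≈⟨ trans (⊚-def _ g (suc n)) (sumTo-suc-head n _) ⟩
    c * 0# + sumTo R n (λ j → 0# * (g ^ suc j) (suc n))                ≈⟨ +-cong (zeroʳ _) (sumTo-≈0 n (λ _ _ → zeroˡ _)) ⟩
    0# + 0#                                                            ≈⟨ +-identityʳ _ ⟩
    0#                                                                 ∎

  ⊚-𝟙 : ∀ g → 𝟙 ⊚ g ≋ 𝟙
  ⊚-𝟙 g = ≋-trans (⊚-congˡ g (≋-sym const-1)) (≋-trans (⊚-const 1# g) const-1)

  𝕏-⊚ : ∀ g → g 0 ≈ 0# → 𝕏 ⊚ g ≋ g
  𝕏-⊚ g g₀≈0 =
    𝕏 ⊚ g                               ≋⟨ ⊚-horner 𝕏 g g₀≈0 ⟩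
    const 0# ⊞ g ⋆ (divX 𝕏 ⊚ g)         ≋⟨ (λ n → +-cong (const-0 n) (⋆-cong ≋-refl (≋-trans (⊚-congˡ g divX-𝕏) (⊚-𝟙 g)) n)) ⟩
    𝟘 ⊞ g ⋆ 𝟙                           ≋⟨ (λ n → trans (+-identityˡ _) (⋆-identityʳ g n)) ⟩
    g                                   ∎≋

  divX-⊚ : ∀ f g → g 0 ≈ 0# → divX (f ⊚ g) ≋ divX g ⋆ (divX f ⊚ g)
  divX-⊚ f g g₀≈0 =
    divX (f ⊚ g)                                   ≋⟨ divX-cong (⊚-horner f g g₀≈0) ⟩
    divX (const (f 0) ⊞ g ⋆ (divX f ⊚ g))          ≋⟨ (λ n → trans (divX-def _ n) (trans (+-identityˡ _) (sym (divX-def _ n)))) ⟩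
    divX (g ⋆ (divX f ⊚ g))                        ≋⟨ divX-⋆ g _ ⟩
    g 0 • divX (divX f ⊚ g) ⊞ divX g ⋆ (divX f ⊚ g) ≋⟨ (λ n → trans (+-congʳ (x≈0⇒x*y≈0 g₀≈0 _)) (+-identityˡ _)) ⟩
    divX g ⋆ (divX f ⊚ g)                          ∎≋

  ⊚-𝕏 : ∀ f → f ⊚ 𝕏 ≋ f
  ⊚-𝕏 = divX-recursion-unique 𝕏 (λ f → const (f 0)) (_⊚ 𝕏) (λ f → f) refl
          (λ f → ⊚-horner f 𝕏 refl) split-𝕏

  ⊚-⋆ : ∀ f h g → g 0 ≈ 0# → (f ⋆ h) ⊚ g ≋ (f ⊚ g) ⋆ (h ⊚ g)
  ⊚-⋆ f h g g₀≈0 = divX-recursion-unique g A (λ f → (f ⋆ h) ⊚ g) (λ f → (f ⊚ g) ⋆ (h ⊚ g)) g₀≈0 lhs-rec rhs-rec f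
    where
    A : PS R → PS R
    A f = const (f 0) ⋆ (h ⊚ g)
    lhs-rec : ∀ f → (f ⋆ h) ⊚ g ≋ A f ⊞ g ⋆ ((divX f ⋆ h) ⊚ g)
    lhs-rec f =
      (f ⋆ h) ⊚ g
        ≋⟨ ⊚-horner (f ⋆ h) g g₀≈0 ⟩
      const ((f ⋆ h) 0) ⊞ g ⋆ (divX (f ⋆ h) ⊚ g)
        ≋⟨ (λ n → +-cong (≋-trans (const-cong (⋆-coeff-0 f h)) (const-* (f 0) (h 0)) n)
                         (⋆-cong ≋-refl (≋-trans (⊚-congˡ g (divX-⋆ f h)) (⊚-⊞ _ _ g)) n)) ⟩
      const (f 0) ⋆ const (h 0) ⊞ g ⋆ ((f 0 • divX h) ⊚ g ⊞ (divX f ⋆ h) ⊚ g)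
        ≋⟨ (λ n → +-congˡ (⋆-cong ≋-refl (λ m → +-congʳ (trans (⊚-• (f 0) (divX h) g m) (sym (const-⋆ (f 0) _ m)))) n)) ⟩
      const (f 0) ⋆ const (h 0) ⊞ g ⋆ (const (f 0) ⋆ (divX h ⊚ g) ⊞ (divX f ⋆ h) ⊚ g)
        ≋⟨ solveS 5 (λ c c′ g h′ F → c ⊗ c′ ⊹ g ⊗ (c ⊗ h′ ⊹ F) ≔ c ⊗ (c′ ⊹ g ⊗ h′) ⊹ g ⊗ F)
                  ≋-refl (const (f 0)) (const (h 0)) g (divX h ⊚ g) ((divX f ⋆ h) ⊚ g) ⟩
      const (f 0) ⋆ (const (h 0) ⊞ g ⋆ (divX h ⊚ g)) ⊞ g ⋆ ((divX f ⋆ h) ⊚ g)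
        ≋⟨ (λ n → +-congʳ (⋆-cong ≋-refl (⊚-horner h g g₀≈0) n)) ⟨
      A f ⊞ g ⋆ ((divX f ⋆ h) ⊚ g) ∎≋
    rhs-rec : ∀ f → (f ⊚ g) ⋆ (h ⊚ g) ≋ A f ⊞ g ⋆ ((divX f ⊚ g) ⋆ (h ⊚ g))
    rhs-rec f =
      (f ⊚ g) ⋆ (h ⊚ g)                                        ≋⟨ ⋆-cong (⊚-horner f g g₀≈0) ≋-refl ⟩
      (const (f 0) ⊞ g ⋆ (divX f ⊚ g)) ⋆ (h ⊚ g)               ≋⟨ solveS 4 (λ c g F H → (c ⊹ g ⊗ F) ⊗ H ≔ c ⊗ H ⊹ g ⊗ (F ⊗ H))
                                                                           ≋-refl (const (f 0)) g (divX f ⊚ g) (h ⊚ g) ⟩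
      A f ⊞ g ⋆ ((divX f ⊚ g) ⋆ (h ⊚ g))                       ∎≋

  ⊚-^ : ∀ f g k → g 0 ≈ 0# → (f ^ k) ⊚ g ≋ (f ⊚ g) ^ k
  ⊚-^ f g zero    g₀≈0 = ⊚-𝟙 g
  ⊚-^ f g (suc k) g₀≈0 = ≋-trans (⊚-⋆ f (f ^ k) g g₀≈0) (⋆-cong ≋-refl (⊚-^ f g k g₀≈0))

  ⊚-assoc : ∀ f g h → g 0 ≈ 0# → h 0 ≈ 0# → (f ⊚ g) ⊚ h ≋ f ⊚ (g ⊚ h)
  ⊚-assoc f g h g₀≈0 h₀≈0 = divX-recursion-unique (g ⊚ h) (λ f → const (f 0)) (λ f → (f ⊚ g) ⊚ h) (_⊚ (g ⊚ h))
                              (trans (⊚-coeff-0 g h) g₀≈0) lhs-rec (λ f → ⊚-horner f (g ⊚ h) (trans (⊚-coeff-0 g h) g₀≈0)) f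
    where
    lhs-rec : ∀ f → (f ⊚ g) ⊚ h ≋ const (f 0) ⊞ (g ⊚ h) ⋆ ((divX f ⊚ g) ⊚ h)
    lhs-rec f =
      (f ⊚ g) ⊚ h                                   ≋⟨ ⊚-congˡ h (⊚-horner f g g₀≈0) ⟩
      (const (f 0) ⊞ g ⋆ (divX f ⊚ g)) ⊚ h          ≋⟨ ⊚-⊞ _ _ h ⟩
      const (f 0) ⊚ h ⊞ (g ⋆ (divX f ⊚ g)) ⊚ h      ≋⟨ (λ n → +-cong (⊚-const (f 0) h n) (⊚-⋆ g (divX f ⊚ g) h h₀≈0 n)) ⟩
      const (f 0) ⊞ (g ⊚ h) ⋆ ((divX f ⊚ g) ⊚ h)    ∎≋

  ∂-⊚ : ∀ f g → g 0 ≈ 0# → ∂ (f ⊚ g) ≋ (∂ f ⊚ g) ⋆ ∂ g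
  ∂-⊚ f g g₀≈0 = divX-recursion-unique g (λ f → (divX f ⊚ g) ⋆ ∂ g) (λ f → ∂ (f ⊚ g)) (λ f → (∂ f ⊚ g) ⋆ ∂ g)
                   g₀≈0 lhs-rec rhs-rec f
    where
    lhs-rec : ∀ f → ∂ (f ⊚ g) ≋ (divX f ⊚ g) ⋆ ∂ g ⊞ g ⋆ ∂ (divX f ⊚ g)
    lhs-rec f =
      ∂ (f ⊚ g)                                               ≋⟨ ∂-cong (⊚-horner f g g₀≈0) ⟩
      ∂ (const (f 0) ⊞ g ⋆ (divX f ⊚ g))                      ≋⟨ ∂-⊞ _ _ ⟩
      ∂ (const (f 0)) ⊞ ∂ (g ⋆ (divX f ⊚ g))                  ≋⟨ (λ n → trans (+-cong (∂-const (f 0) n) (∂-⋆ g _ n)) (+-identityˡ _)) ⟩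
      ∂ g ⋆ (divX f ⊚ g) ⊞ g ⋆ ∂ (divX f ⊚ g)                 ≋⟨ (λ n → +-congʳ (⋆-comm _ _ n)) ⟩
      (divX f ⊚ g) ⋆ ∂ g ⊞ g ⋆ ∂ (divX f ⊚ g)                 ∎≋
    rhs-rec : ∀ f → (∂ f ⊚ g) ⋆ ∂ g ≋ (divX f ⊚ g) ⋆ ∂ g ⊞ g ⋆ ((∂ (divX f) ⊚ g) ⋆ ∂ g)
    rhs-rec f =
      (∂ f ⊚ g) ⋆ ∂ g                                         ≋⟨ ⋆-cong (⊚-congˡ g (∂-split-𝕏 f)) ≋-refl ⟩
      ((divX f ⊞ 𝕏 ⋆ ∂ (divX f)) ⊚ g) ⋆ ∂ g                   ≋⟨ ⋆-cong (⊚-⊞ _ _ g) ≋-refl ⟩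
      (divX f ⊚ g ⊞ (𝕏 ⋆ ∂ (divX f)) ⊚ g) ⋆ ∂ g               ≋⟨ ⋆-cong (λ n → +-congˡ (trans (⊚-⋆ 𝕏 _ g g₀≈0 n) (⋆-cong (𝕏-⊚ g g₀≈0) ≋-refl n))) ≋-refl ⟩
      (divX f ⊚ g ⊞ g ⋆ (∂ (divX f) ⊚ g)) ⋆ ∂ g               ≋⟨ solveS 4 (λ F g F′ dg → (F ⊹ g ⊗ F′) ⊗ dg ≔ F ⊗ dg ⊹ g ⊗ (F′ ⊗ dg))
                                                                          ≋-refl (divX f ⊚ g) g (∂ (divX f) ⊚ g) (∂ g) ⟩
      (divX f ⊚ g) ⋆ ∂ g ⊞ g ⋆ ((∂ (divX f) ⊚ g) ⋆ ∂ g)       ∎≋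

  ⊚-coeff-suc : ∀ f g → g 0 ≈ 0# → ∀ m →
                (f ⊚ g) (suc m) ≈ sumTo R m (λ i → g i * (divX f ⊚ g) (suc m ∸ i)) + f 1 * g (suc m)
  ⊚-coeff-suc f g g₀≈0 m = begin
    (f ⊚ g) (suc m)                                                        ≈⟨ ⊚-horner f g g₀≈0 (suc m) ⟩
    0# + (g ⋆ T) (suc m)                                                   ≈⟨ trans (+-identityˡ _) (⋆-def g T (suc m)) ⟩
    sumTo R m (λ i → g i * T (suc m ∸ i)) + g (suc m) * T (m ∸ m)          ≈⟨ +-congˡ (trans (*-comm _ _) (*-congʳ T[m∸m]≈f₁)) ⟩
    sumTo R m (λ i → g i * T (suc m ∸ i)) + f 1 * g (suc m)                ∎
    where
    T = divX f ⊚ g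
    T[m∸m]≈f₁ : T (m ∸ m) ≈ f 1
    T[m∸m]≈f₁ = trans (reflexive (≡.cong T (ℕ.n∸n≡0 m))) (trans (⊚-coeff-0 (divX f) g) (divX-def f 0))

  ⊚-coeff-1 : ∀ f g → g 0 ≈ 0# → (f ⊚ g) 1 ≈ f 1 * g 1
  ⊚-coeff-1 f g g₀≈0 = trans (⊚-coeff-suc f g g₀≈0 0) (trans (+-congʳ (x≈0⇒x*y≈0 g₀≈0 _)) (+-identityˡ _))

  -- Comparing coefficient m + 1 of f ⊚ g and f ⊚ g′: only the last summand sees g (m + 1) and g′ (m + 1).
  ⊚-cancelˡ : ∀ f {g g′} → ¬ (f 1 ≈ 0#) → g 0 ≈ 0# → g′ 0 ≈ 0# → f ⊚ g ≋ f ⊚ g′ → g ≋ g′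
  ⊚-cancelˡ f {g} {g′} f₁≉0 g₀≈0 g′₀≈0 fg≋fg′ n = <-rec (λ n → g n ≈ g′ n) step n
    where
    open import Algebra.Properties.Group +-group using () renaming (∙-cancelˡ to +-cancelˡ)
    step : ∀ n → (∀ {i} → i < n → g i ≈ g′ i) → g n ≈ g′ n
    step zero    _  = trans g₀≈0 (sym g′₀≈0)
    step (suc m) ih = *-cancelˡ f₁≉0 (+-cancelˡ _ _ _ (begin
      sumTo R m (λ i → g i * (divX f ⊚ g) (suc m ∸ i)) + f 1 * g (suc m)
        ≈⟨ ⊚-coeff-suc f g g₀≈0 m ⟨
      (f ⊚ g) (suc m)
        ≈⟨ fg≋fg′ (suc m) ⟩
      (f ⊚ g′) (suc m)
        ≈⟨ ⊚-coeff-suc f g′ g′₀≈0 m ⟩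
      sumTo R m (λ i → g′ i * (divX f ⊚ g′) (suc m ∸ i)) + f 1 * g′ (suc m)
        ≈⟨ +-congʳ (sumTo-congᵇ m lower-terms) ⟨
      sumTo R m (λ i → g i * (divX f ⊚ g) (suc m ∸ i)) + f 1 * g′ (suc m) ∎))
      where
      lower-terms : ∀ i → i ≤ m → g i * (divX f ⊚ g) (suc m ∸ i) ≈ g′ i * (divX f ⊚ g′) (suc m ∸ i)
      lower-terms zero    _       = trans (x≈0⇒x*y≈0 g₀≈0 _) (sym (x≈0⇒x*y≈0 g′₀≈0 _))
      lower-terms (suc i) 1+i≤m   = *-cong (ih (s≤s 1+i≤m))
        (⊚-congʳ-upto (divX f) (m ∸ i) (λ j j≤m∸i → ih (s≤s (ℕ.≤-trans j≤m∸i (ℕ.m∸n≤m m i)))))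

  ^S≋^ : ∀ g k → _^S_ R g k ≋ g ^ k
  ^S≋^ g zero    = ≋-refl
  ^S≋^ g (suc k) = ≋-trans (⊛≋⋆ g (_^S_ R g k)) (⋆-cong ≋-refl (^S≋^ g k))

  ∘S≋⊚ : ∀ f g → _∘S_ R f g ≋ f ⊚ g
  ∘S≋⊚ f g n = trans (sumTo-cong n (λ j → *-congˡ (^S≋^ g j n))) (sym (⊚-def f g n))

  -- Defs keeps the table of partial reciprocals private; the underscore is its k-th entry at stage n.
  mutual
    recip-suc : ∀ g n → recip R g (suc n) ≈ - ((g 0) ⁻¹ * sumTo R n (λ i → g (suc i) * recip R g (n ∸ i)))
    recip-suc g n with suc n ℕ.≤? n
    ... | yes 1+n≤n = ⊥-elim (ℕ.<-irrefl ≡.refl 1+n≤n)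
    ... | no  _     = -‿cong (*-congˡ (sumTo-congᵇ n (λ i _ → *-congˡ (recip-stage-∸ g n i))))

    recip-stage-∸ : ∀ g n i → _ ≈ recip R g (n ∸ i)
    recip-stage-∸ g n i with n ∸ i | ℕ.m∸n≤m n i
    ... | k | k≤n = recip-stage g n k k≤n

    recip-stage : ∀ g n k → k ≤ n → _ ≈ recip R g k
    recip-stage g zero    zero k≤n = refl
    recip-stage g (suc n) k    k≤1+n with k ℕ.≤? n
    ... | yes k≤n = recip-stage g n k k≤n
    ... | no  k≰n with ℕ.≤-antisym k≤1+n (ℕ.≰⇒> k≰n)
    ... | ≡.refl with suc n ℕ.≤? n
    ... | yes 1+n≤n = ⊥-elim (ℕ.<-irrefl ≡.refl 1+n≤n)
    ... | no  _     = refl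

  ⋆-recip : ∀ g → ¬ (g 0 ≈ 0#) → g ⋆ recip R g ≋ 𝟙
  ⋆-recip g g₀≉0 zero    = trans (⋆-coeff-0 g _) (inverseʳ (g 0) g₀≉0)
  ⋆-recip g g₀≉0 (suc n) = begin
    (g ⋆ r) (suc n)                                 ≈⟨ ⋆-coeff-suc g r n ⟩
    g 0 * r (suc n) + (divX g ⋆ r) n                ≈⟨ +-cong (*-congˡ (recip-suc g n)) (trans (⋆-def (divX g) r n) (sumTo-cong n (λ i → *-congʳ (divX-def g i)))) ⟩
    g 0 * - ((g 0) ⁻¹ * S) + S                      ≈⟨ +-congʳ (solve 3 (λ a b c → a :* (:- (b :* c)) := :- ((a :* b) :* c)) refl (g 0) ((g 0) ⁻¹) S) ⟩
    - ((g 0 * (g 0) ⁻¹) * S) + S                    ≈⟨ +-congʳ (-‿cong (trans (*-congʳ (inverseʳ (g 0) g₀≉0)) (*-identityˡ S))) ⟩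
    - S + S                                         ≈⟨ -‿inverseˡ S ⟩
    0#                                              ∎
    where
    r = recip R g
    S = sumTo R n (λ i → g (suc i) * r (n ∸ i))

  exp log1p : PS R
  exp   = expS R
  log1p = log1pS R

  exp-coeff-0 : exp 0 ≈ 1#
  exp-coeff-0 = trans (⁻¹-cong nat-1) 1⁻¹≈1

  exp-coeff-1 : exp 1 ≈ 1#
  exp-coeff-1 = trans (⁻¹-cong nat-1) 1⁻¹≈1

  ∂-exp : ∂ exp ≋ exp
  ∂-exp n = begin
    ∂ exp n                                                ≈⟨ ∂-def exp n ⟩
    nat R (suc n) * (nat R (suc n ℕ.* n !)) ⁻¹             ≈⟨ *-congˡ (⁻¹-cong (nat-homo-* (suc n) (n !))) ⟩
    nat R (suc n) * (nat R (suc n) * nat R (n !)) ⁻¹       ≈⟨ *-congˡ (⁻¹-distrib-* (nat-suc≉0 n) (nat-!≉0 n)) ⟩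
    nat R (suc n) * ((nat R (suc n)) ⁻¹ * (nat R (n !)) ⁻¹) ≈⟨ x*[x⁻¹*y]≈y _ (nat-suc≉0 n) ⟩
    exp n                                                  ∎

  log1p-coeff-1 : log1p 1 ≈ 1#
  log1p-coeff-1 = trans (*-identityˡ _) (trans (⁻¹-cong nat-1) 1⁻¹≈1)

  ∂-log1p-0 : ∂ log1p 0 ≈ 1#
  ∂-log1p-0 = trans (∂-def log1p 0) (trans (*-congʳ nat-1) (trans (*-identityˡ _) log1p-coeff-1))

  -- The coefficients of log1p are sign n * (n + 1)⁻¹ with a sign function local to Defs, left implicit here.
  ∂-log1p-suc : ∀ n → ∂ log1p (suc n) ≈ - ∂ log1p n
  ∂-log1p-suc n = trans (∂-def log1p (suc n))
    (trans (cancel (suc n)) (-‿cong (sym (trans (∂-def log1p n) (cancel n)))))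
    where
    cancel : ∀ n {s} → nat R (suc n) * (s * (nat R (suc n)) ⁻¹) ≈ s
    cancel n {s} = trans (*-congˡ (*-comm s _)) (x*[x⁻¹*y]≈y s (nat-suc≉0 n))

  [1+𝕏]⋆∂-coeff : ∀ f n → ((𝟙 ⊞ 𝕏) ⋆ ∂ f) n ≈ nat R (suc n) * f (suc n) + nat R n * f n
  [1+𝕏]⋆∂-coeff f zero    = trans (⋆-distribʳ 𝟙 𝕏 (∂ f) 0)
    (+-cong (trans (⋆-identityˡ _ 0) (∂-def f 0)) (trans (𝕏⋆-coeff-0 _) (sym (zeroˡ _))))
  [1+𝕏]⋆∂-coeff f (suc n) = trans (⋆-distribʳ 𝟙 𝕏 (∂ f) (suc n))
    (+-cong (trans (⋆-identityˡ _ (suc n)) (∂-def f (suc n))) (trans (𝕏⋆-coeff-suc _ n) (∂-def f n)))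

  [1+𝕏]⋆∂log1p≋1 : (𝟙 ⊞ 𝕏) ⋆ ∂ log1p ≋ 𝟙
  [1+𝕏]⋆∂log1p≋1 zero    = trans (⋆-distribʳ 𝟙 𝕏 (∂ log1p) 0)
    (trans (+-cong (trans (⋆-identityˡ _ 0) ∂-log1p-0) (𝕏⋆-coeff-0 _)) (+-identityʳ _))
  [1+𝕏]⋆∂log1p≋1 (suc n) = trans (⋆-distribʳ 𝟙 𝕏 (∂ log1p) (suc n))
    (trans (+-cong (trans (⋆-identityˡ _ (suc n)) (∂-log1p-suc n)) (𝕏⋆-coeff-suc _ n)) (-‿inverseˡ _))

  -- At coefficient n, (1 + t) f′ ≋ f reads (n + 1) f (n + 1) + n f n ≈ f n.
  [1+𝕏]⋆∂-fixed-unique : ∀ f g → (𝟙 ⊞ 𝕏) ⋆ ∂ f ≋ f → (𝟙 ⊞ 𝕏) ⋆ ∂ g ≋ g → f 0 ≈ g 0 → f ≋ g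
  [1+𝕏]⋆∂-fixed-unique f g f-fixed g-fixed f₀≈g₀ zero    = f₀≈g₀
  [1+𝕏]⋆∂-fixed-unique f g f-fixed g-fixed f₀≈g₀ (suc n) = *-cancelˡ (nat-suc≉0 n) (begin
    nat R (suc n) * f (suc n)       ≈⟨ next-coeff f f-fixed ⟩
    f n - nat R n * f n             ≈⟨ +-cong fₙ≈gₙ (-‿cong (*-congˡ fₙ≈gₙ)) ⟩
    g n - nat R n * g n             ≈⟨ next-coeff g g-fixed ⟨
    nat R (suc n) * g (suc n)       ∎)
    where
    fₙ≈gₙ = [1+𝕏]⋆∂-fixed-unique f g f-fixed g-fixed f₀≈g₀ n
    next-coeff : ∀ h → (𝟙 ⊞ 𝕏) ⋆ ∂ h ≋ h → nat R (suc n) * h (suc n) ≈ h n - nat R n * h n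
    next-coeff h h-fixed = begin
      nat R (suc n) * h (suc n)                                          ≈⟨ solve 2 (λ x y → x := (x :+ y) :- y) refl _ _ ⟩
      (nat R (suc n) * h (suc n) + nat R n * h n) - nat R n * h n        ≈⟨ +-congʳ (trans (sym ([1+𝕏]⋆∂-coeff h n)) (h-fixed n)) ⟩
      h n - nat R n * h n                                                ∎

  exp⊚log1p≋1+𝕏 : exp ⊚ log1p ≋ 𝟙 ⊞ 𝕏
  exp⊚log1p≋1+𝕏 = [1+𝕏]⋆∂-fixed-unique (exp ⊚ log1p) (𝟙 ⊞ 𝕏) exp⊚log1p-fixed 1+𝕏-fixed
                    (trans (⊚-coeff-0 exp log1p) (trans exp-coeff-0 (sym (+-identityʳ _))))
    where
    exp⊚log1p-fixed : (𝟙 ⊞ 𝕏) ⋆ ∂ (exp ⊚ log1p) ≋ exp ⊚ log1p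
    exp⊚log1p-fixed =
      (𝟙 ⊞ 𝕏) ⋆ ∂ (exp ⊚ log1p)                            ≋⟨ ⋆-cong ≋-refl (∂-⊚ exp log1p refl) ⟩
      (𝟙 ⊞ 𝕏) ⋆ ((∂ exp ⊚ log1p) ⋆ ∂ log1p)                ≋⟨ ⋆-cong ≋-refl (⋆-cong (⊚-congˡ log1p ∂-exp) ≋-refl) ⟩
      (𝟙 ⊞ 𝕏) ⋆ ((exp ⊚ log1p) ⋆ ∂ log1p)                  ≋⟨ solveS 3 (λ a f l → a ⊗ (f ⊗ l) ≔ f ⊗ (a ⊗ l)) ≋-refl (𝟙 ⊞ 𝕏) (exp ⊚ log1p) (∂ log1p) ⟩
      (exp ⊚ log1p) ⋆ ((𝟙 ⊞ 𝕏) ⋆ ∂ log1p)                  ≋⟨ ⋆-cong ≋-refl [1+𝕏]⋆∂log1p≋1 ⟩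
      (exp ⊚ log1p) ⋆ 𝟙                                    ≋⟨ ⋆-identityʳ _ ⟩
      exp ⊚ log1p                                          ∎≋
    1+𝕏-fixed : (𝟙 ⊞ 𝕏) ⋆ ∂ (𝟙 ⊞ 𝕏) ≋ 𝟙 ⊞ 𝕏
    1+𝕏-fixed =
      (𝟙 ⊞ 𝕏) ⋆ ∂ (𝟙 ⊞ 𝕏)       ≋⟨ ⋆-cong ≋-refl (≋-trans (∂-⊞ 𝟙 𝕏) (λ n → trans (+-cong (∂-𝟙 n) (∂-𝕏 n)) (+-identityˡ _))) ⟩
      (𝟙 ⊞ 𝕏) ⋆ 𝟙               ≋⟨ ⋆-identityʳ _ ⟩
      𝟙 ⊞ 𝕏                     ∎≋

  ∂-inverse : ∀ ψ φ → ψ ⋆ φ ≋ 𝟙 → ∂ φ ≋ negate (φ ⋆ φ ⋆ ∂ ψ)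
  ∂-inverse ψ φ ψφ≋1 =
    ∂ φ                                          ≋⟨ ⋆-identityʳ (∂ φ) ⟨
    ∂ φ ⋆ 𝟙                                      ≋⟨ ⋆-cong ≋-refl ψφ≋1 ⟨
    ∂ φ ⋆ (ψ ⋆ φ)                                ≋⟨ solveS 4 (λ f p df dp → df ⊗ (p ⊗ f) ≔ f ⊗ (dp ⊗ f ⊹ p ⊗ df) ⊝ f ⊗ f ⊗ dp)
                                                             ≋-refl φ ψ (∂ φ) (∂ ψ) ⟩
    φ ⋆ (∂ ψ ⋆ φ ⊞ ψ ⋆ ∂ φ) ⊟ φ ⋆ φ ⋆ ∂ ψ         ≋⟨ (λ n → +-congʳ (trans (⋆-cong ≋-refl ∂[ψφ]≋0 n) (⋆-zeroʳ φ n))) ⟩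
    𝟘 ⊟ φ ⋆ φ ⋆ ∂ ψ                              ≋⟨ (λ n → +-identityˡ _) ⟩
    negate (φ ⋆ φ ⋆ ∂ ψ)                         ∎≋
    where
    ∂[ψφ]≋0 : ∂ ψ ⋆ φ ⊞ ψ ⋆ ∂ φ ≋ 𝟘
    ∂[ψφ]≋0 = ≋-trans (≋-sym (∂-⋆ ψ φ)) (≋-trans (∂-cong ψφ≋1) ∂-𝟙)

  module LagrangeInversion (ψ φ : PS R) (ψφ≋1 : ψ ⋆ φ ≋ 𝟙) where

    D : PS R
    D = 𝕏 ⋆ ψ

    D₀≈0 : D 0 ≈ 0#
    D₀≈0 = 𝕏⋆-coeff-0 ψ

    D₁≉0 : ¬ (D 1 ≈ 0#)
    D₁≉0 D₁≈0 = 0≉1 (begin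
      0#            ≈⟨ x≈0⇒x*y≈0 (trans (sym (𝕏⋆-coeff-suc ψ 0)) D₁≈0) (φ 0) ⟨
      ψ 0 * φ 0     ≈⟨ ⋆-coeff-0 ψ φ ⟨
      (ψ ⋆ φ) 0     ≈⟨ ψφ≋1 0 ⟩
      1#            ∎)

    φ^[1+N]⋆∂D : ∀ N → φ ^ suc N ⋆ ∂ D ≋ φ ^ N ⊞ 𝕏 ⋆ (φ ^ suc N ⋆ ∂ ψ)
    φ^[1+N]⋆∂D N =
      φ ^ suc N ⋆ ∂ D                              ≋⟨ ⋆-cong ≋-refl (∂-𝕏⋆ ψ) ⟩
      (φ ⋆ φ ^ N) ⋆ (ψ ⊞ 𝕏 ⋆ ∂ ψ)                  ≋⟨ solveS 5 (λ f P p x dp → (f ⊗ P) ⊗ (p ⊹ x ⊗ dp) ≔ P ⊗ (p ⊗ f) ⊹ x ⊗ ((f ⊗ P) ⊗ dp))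
                                                              ≋-refl φ (φ ^ N) ψ 𝕏 (∂ ψ) ⟩
      φ ^ N ⋆ (ψ ⋆ φ) ⊞ 𝕏 ⋆ (φ ^ suc N ⋆ ∂ ψ)      ≋⟨ (λ n → +-congʳ (trans (⋆-cong ≋-refl ψφ≋1 n) (⋆-identityʳ _ n))) ⟩
      φ ^ N ⊞ 𝕏 ⋆ (φ ^ suc N ⋆ ∂ ψ)                ∎≋

    -- For N = K + 1 the two summands cancel: up to the factor N, both are coefficient K of ∂ (φ ^ N) = - N φ ^ (N + 1) ∂ψ.
    φ^[1+N]⋆∂D-coeff : ∀ N → (φ ^ suc N ⋆ ∂ D) N ≈ 𝟙 N
    φ^[1+N]⋆∂D-coeff zero    = trans (φ^[1+N]⋆∂D 0 0) (trans (+-congˡ (𝕏⋆-coeff-0 _)) (+-identityʳ _))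
    φ^[1+N]⋆∂D-coeff (suc K) = begin
      (φ ^ suc (suc K) ⋆ ∂ D) (suc K)                  ≈⟨ trans (φ^[1+N]⋆∂D (suc K) (suc K)) (+-congˡ (𝕏⋆-coeff-suc _ K)) ⟩
      (φ ^ suc K) (suc K) + (φ ^ suc (suc K) ⋆ ∂ ψ) K   ≈⟨ +-congʳ (*-cancelˡ (nat-suc≉0 K) (trans (sym (∂-def _ K)) (∂φ^[1+K] K))) ⟩
      - (φ ^ suc (suc K) ⋆ ∂ ψ) K + (φ ^ suc (suc K) ⋆ ∂ ψ) K ≈⟨ -‿inverseˡ _ ⟩
      0#                                               ∎
      where
      ∂φ^[1+K] : ∂ (φ ^ suc K) ≋ nat R (suc K) • negate (φ ^ suc (suc K) ⋆ ∂ ψ)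
      ∂φ^[1+K] =
        ∂ (φ ^ suc K)                                ≋⟨ ∂-^ φ K ⟩
        nat R (suc K) • (φ ^ K ⋆ ∂ φ)                ≋⟨ •-cong refl (⋆-cong ≋-refl (∂-inverse ψ φ ψφ≋1)) ⟩
        nat R (suc K) • (φ ^ K ⋆ negate (φ ⋆ φ ⋆ ∂ ψ)) ≋⟨ •-cong refl (solveS 3 (λ f P dp → P ⊗ (⊝ (f ⊗ f ⊗ dp)) ≔ ⊝ ((f ⊗ (f ⊗ P)) ⊗ dp))
                                                                         ≋-refl φ (φ ^ K) (∂ ψ)) ⟩
        nat R (suc K) • negate (φ ^ suc (suc K) ⋆ ∂ ψ) ∎≋

    -- The formal residue of Q(D) D′ / D ^ (N + 1) is Q N.
    residue : ∀ N Q → (φ ^ suc N ⋆ ((Q ⊚ D) ⋆ ∂ D)) N ≈ Q N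
    residue N Q = trans (expand N N) (coeff N)
      where
      expand : ∀ N → φ ^ suc N ⋆ ((Q ⊚ D) ⋆ ∂ D) ≋ const (Q 0) ⋆ (φ ^ suc N ⋆ ∂ D) ⊞ 𝕏 ⋆ (φ ^ N ⋆ ((divX Q ⊚ D) ⋆ ∂ D))
      expand N =
        φ ^ suc N ⋆ ((Q ⊚ D) ⋆ ∂ D)
          ≋⟨ ⋆-cong ≋-refl (⋆-cong (⊚-horner Q D D₀≈0) ≋-refl) ⟩
        (φ ⋆ φ ^ N) ⋆ ((const (Q 0) ⊞ (𝕏 ⋆ ψ) ⋆ (divX Q ⊚ D)) ⋆ ∂ D)
          ≋⟨ solveS 7 (λ f P c x p a dD → (f ⊗ P) ⊗ ((c ⊹ (x ⊗ p) ⊗ a) ⊗ dD) ≔ c ⊗ ((f ⊗ P) ⊗ dD) ⊹ (p ⊗ f) ⊗ (x ⊗ (P ⊗ (a ⊗ dD))))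
                    ≋-refl φ (φ ^ N) (const (Q 0)) 𝕏 ψ (divX Q ⊚ D) (∂ D) ⟩
        const (Q 0) ⋆ (φ ^ suc N ⋆ ∂ D) ⊞ (ψ ⋆ φ) ⋆ (𝕏 ⋆ (φ ^ N ⋆ ((divX Q ⊚ D) ⋆ ∂ D)))
          ≋⟨ (λ n → +-congˡ (trans (⋆-cong ψφ≋1 ≋-refl n) (⋆-identityˡ _ n))) ⟩
        const (Q 0) ⋆ (φ ^ suc N ⋆ ∂ D) ⊞ 𝕏 ⋆ (φ ^ N ⋆ ((divX Q ⊚ D) ⋆ ∂ D)) ∎≋
      coeff : ∀ N → (const (Q 0) ⋆ (φ ^ suc N ⋆ ∂ D) ⊞ 𝕏 ⋆ (φ ^ N ⋆ ((divX Q ⊚ D) ⋆ ∂ D))) N ≈ Q N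
      coeff zero    = begin
        (const (Q 0) ⋆ (φ ^ 1 ⋆ ∂ D)) 0 + (𝕏 ⋆ _) 0      ≈⟨ +-cong (trans (const-⋆ _ _ 0) (*-congˡ (φ^[1+N]⋆∂D-coeff 0))) (𝕏⋆-coeff-0 _) ⟩
        Q 0 * 1# + 0#                                   ≈⟨ trans (+-identityʳ _) (*-identityʳ _) ⟩
        Q 0                                             ∎
      coeff (suc K) = begin
        (const (Q 0) ⋆ (φ ^ suc (suc K) ⋆ ∂ D)) (suc K) + (𝕏 ⋆ (φ ^ suc K ⋆ ((divX Q ⊚ D) ⋆ ∂ D))) (suc K)
          ≈⟨ +-cong (trans (const-⋆ _ _ (suc K)) (trans (*-congˡ (φ^[1+N]⋆∂D-coeff (suc K))) (zeroʳ _))) (𝕏⋆-coeff-suc _ K) ⟩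
        0# + (φ ^ suc K ⋆ ((divX Q ⊚ D) ⋆ ∂ D)) K
          ≈⟨ trans (+-identityˡ _) (residue K (divX Q)) ⟩
        divX Q K
          ≈⟨ divX-def Q K ⟩
        Q (suc K) ∎

    module _ (W : PS R) (W₀≈0 : W 0 ≈ 0#) (D⊚W≋𝕏 : D ⊚ W ≋ 𝕏) where

      W⊚D≋𝕏 : W ⊚ D ≋ 𝕏
      W⊚D≋𝕏 = ⊚-cancelˡ D D₁≉0 (trans (⊚-coeff-0 W D) W₀≈0) refl (
        D ⊚ (W ⊚ D)     ≋⟨ ⊚-assoc D W D W₀≈0 D₀≈0 ⟨
        (D ⊚ W) ⊚ D     ≋⟨ ⊚-congˡ D D⊚W≋𝕏 ⟩
        𝕏 ⊚ D           ≋⟨ 𝕏-⊚ D D₀≈0 ⟩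
        D               ≋⟨ ⊚-𝕏 D ⟨
        D ⊚ 𝕏           ∎≋)

      ∂[H⊚W]⊚D⋆∂D≋∂H : ∀ H → (∂ (H ⊚ W) ⊚ D) ⋆ ∂ D ≋ ∂ H
      ∂[H⊚W]⊚D⋆∂D≋∂H H =
        (∂ (H ⊚ W) ⊚ D) ⋆ ∂ D                    ≋⟨ ⋆-cong (⊚-congˡ D (∂-⊚ H W W₀≈0)) ≋-refl ⟩
        (((∂ H ⊚ W) ⋆ ∂ W) ⊚ D) ⋆ ∂ D            ≋⟨ ⋆-cong (⊚-⋆ (∂ H ⊚ W) (∂ W) D D₀≈0) ≋-refl ⟩
        (((∂ H ⊚ W) ⊚ D) ⋆ (∂ W ⊚ D)) ⋆ ∂ D      ≋⟨ ⋆-cong (⋆-cong ∂H⊚W⊚D≋∂H ≋-refl) ≋-refl ⟩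
        (∂ H ⋆ (∂ W ⊚ D)) ⋆ ∂ D                  ≋⟨ ⋆-assoc _ _ _ ⟩
        ∂ H ⋆ ((∂ W ⊚ D) ⋆ ∂ D)                  ≋⟨ ⋆-cong ≋-refl (∂-⊚ W D D₀≈0) ⟨
        ∂ H ⋆ ∂ (W ⊚ D)                          ≋⟨ ⋆-cong ≋-refl (≋-trans (∂-cong W⊚D≋𝕏) ∂-𝕏) ⟩
        ∂ H ⋆ 𝟙                                  ≋⟨ ⋆-identityʳ _ ⟩
        ∂ H                                      ∎≋
        where
        ∂H⊚W⊚D≋∂H : (∂ H ⊚ W) ⊚ D ≋ ∂ H
        ∂H⊚W⊚D≋∂H = ≋-trans (⊚-assoc (∂ H) W D W₀≈0 D₀≈0) (≋-trans (⊚-congʳ (∂ H) W⊚D≋𝕏) (⊚-𝕏 (∂ H)))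

      lagrange : ∀ H m → nat R (suc m) * (H ⊚ W) (suc m) ≈ (φ ^ suc m ⋆ ∂ H) m
      lagrange H m = begin
        nat R (suc m) * (H ⊚ W) (suc m)                     ≈⟨ ∂-def _ m ⟨
        ∂ (H ⊚ W) m                                         ≈⟨ residue m (∂ (H ⊚ W)) ⟨
        (φ ^ suc m ⋆ ((∂ (H ⊚ W) ⊚ D) ⋆ ∂ D)) m             ≈⟨ ⋆-cong ≋-refl (∂[H⊚W]⊚D⋆∂D≋∂H H) m ⟩
        (φ ^ suc m ⋆ ∂ H) m                                 ∎

module DegenerateExponentialSeries (R : RealField) (lam : RealField.Carrier R)
                                  (lam≉0 : ¬ (RealField._≈_ R lam (RealField.0# R))) where
  open RealField R hiding (_<_)
  open RealFieldProperties R
  open FormalPowerSeries R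
  open IntegerRingSolver commRing using (solve; _:=_; _:+_; _:*_; _:-_)
  open import Algebra.Properties.Ring ring using (-0#≈0#)
  open import Relation.Binary.Reasoning.Setoid setoid

  λ𝕏 ℓ L D ψ φ G : PS R
  λ𝕏 = lam • 𝕏
  ℓ  = lam ⁻¹ • (log1p ⊚ λ𝕏)
  L  = lam ⁻¹ • (exp ⊚ λ𝕏 ⊟ 𝟙)
  D  = divX (exp ⊟ 𝟙) ⊟ 𝟙
  ψ  = divX D
  φ  = tOverD R
  G  = divX L ⋆ φ

  logEλ≋ℓ : logEλ R lam ≋ ℓ
  logEλ≋ℓ n = *-congˡ (∘S≋⊚ log1p λ𝕏 n)

  Dser≋D : Dser R ≋ D
  Dser≋D n = +-congʳ (divT≋divX _ n)

  logλExpOverD≋G : logλExpOverD R lam ≋ G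
  logλExpOverD≋G = ≋-trans (⊛≋⋆ _ φ) (⋆-cong (≋-trans (divT≋divX _) (divX-cong logλExp≋L)) ≋-refl)
    where
    logλExp≋L : logλExp R lam ≋ L
    logλExp≋L n = *-congˡ (+-congʳ (∘S≋⊚ exp λ𝕏 n))

  λ𝕏₀≈0 : λ𝕏 0 ≈ 0#
  λ𝕏₀≈0 = zeroʳ lam

  ℓ₀≈0 : ℓ 0 ≈ 0#
  ℓ₀≈0 = trans (*-congˡ (⊚-coeff-0 log1p λ𝕏)) (zeroʳ _)

  ℓ₁≈1 : ℓ 1 ≈ 1#
  ℓ₁≈1 = begin
    lam ⁻¹ * (log1p ⊚ λ𝕏) 1     ≈⟨ *-congˡ (⊚-coeff-1 log1p λ𝕏 λ𝕏₀≈0) ⟩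
    lam ⁻¹ * (log1p 1 * λ𝕏 1)   ≈⟨ *-congˡ (*-cong log1p-coeff-1 (*-identityʳ lam)) ⟩
    lam ⁻¹ * (1# * lam)         ≈⟨ *-congˡ (*-identityˡ lam) ⟩
    lam ⁻¹ * lam                ≈⟨ inverseˡ lam lam≉0 ⟩
    1#                          ∎

  D₀≈0 : D 0 ≈ 0#
  D₀≈0 = trans (+-congʳ (trans (divX-def _ 0) (trans (+-cong exp-coeff-1 -0#≈0#) (+-identityʳ _)))) (-‿inverseʳ _)

  ψφ≋1 : ψ ⋆ φ ≋ 𝟙
  ψφ≋1 = ≋-trans (⋆-cong (≋-sym (≋-trans (divT≋divX _) (divX-cong Dser≋D))) ≋-refl) (⋆-recip (divT R (Dser R)) D₁≉0)
    where
    D₁≉0 : ¬ (divT R (Dser R) 0 ≈ 0#)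
    D₁≉0 D₁≈0 = ⁻¹-≉0 (nat-suc≉0 1) (trans (sym D₁≈2⁻¹) D₁≈0)
      where
      D₁≈2⁻¹ : divT R (Dser R) 0 ≈ (nat R 2) ⁻¹
      D₁≈2⁻¹ = trans (+-congˡ -0#≈0#) (trans (+-identityʳ _) (trans (+-congˡ -0#≈0#) (+-identityʳ _)))

  D≋𝕏⋆ψ : D ≋ 𝕏 ⋆ ψ
  D≋𝕏⋆ψ = split-𝕏₀ D D₀≈0

  eYλ≋D⊚ℓ : eYλ R lam ≋ D ⊚ ℓ
  eYλ≋D⊚ℓ =
    eYλ R lam                                          ≋⟨ (λ n → +-congʳ (trans (⊛≋⋆ _ r n) (⋆-cong (≋-trans (divT≋divX _) (divX-cong eλ-1≋)) ≋-refl n))) ⟩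
    divX ((exp ⊟ 𝟙) ⊚ ℓ) ⋆ r ⊟ 𝟙                        ≋⟨ (λ n → +-congʳ (⋆-cong (divX-⊚ (exp ⊟ 𝟙) ℓ ℓ₀≈0) ≋-refl n)) ⟩
    (divX ℓ ⋆ (divX (exp ⊟ 𝟙) ⊚ ℓ)) ⋆ r ⊟ 𝟙             ≋⟨ (λ n → +-congʳ (cancel-ℓ n)) ⟩
    divX (exp ⊟ 𝟙) ⊚ ℓ ⊟ 𝟙                              ≋⟨ (λ n → +-congˡ (-‿cong (⊚-𝟙 ℓ n))) ⟨
    divX (exp ⊟ 𝟙) ⊚ ℓ ⊟ 𝟙 ⊚ ℓ                          ≋⟨ ⊚-⊟ _ 𝟙 ℓ ⟨
    D ⊚ ℓ                                              ∎≋
    where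
    r = recip R (divT R (logEλ R lam))
    eλ-1≋ : eλ R lam ⊟ 𝟙 ≋ (exp ⊟ 𝟙) ⊚ ℓ
    eλ-1≋ n = trans (+-cong (trans (∘S≋⊚ exp _ n) (⊚-congʳ exp logEλ≋ℓ n)) (-‿cong (sym (⊚-𝟙 ℓ n)))) (sym (⊚-⊟ exp 𝟙 ℓ n))
    ℓ/𝕏⋆r≋1 : divX ℓ ⋆ r ≋ 𝟙
    ℓ/𝕏⋆r≋1 = ≋-trans (⋆-cong (≋-sym (≋-trans (divT≋divX _) (divX-cong logEλ≋ℓ))) ≋-refl)
      (⋆-recip (divT R (logEλ R lam)) (λ ≈0 → 0≉1 (sym (trans (sym ℓ₁≈1) (trans (sym (logEλ≋ℓ 1)) ≈0)))))
    cancel-ℓ : (divX ℓ ⋆ (divX (exp ⊟ 𝟙) ⊚ ℓ)) ⋆ r ≋ divX (exp ⊟ 𝟙) ⊚ ℓ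
    cancel-ℓ =
      (divX ℓ ⋆ F) ⋆ r       ≋⟨ solveS 3 (λ a b c → (a ⊗ b) ⊗ c ≔ (a ⊗ c) ⊗ b) ≋-refl (divX ℓ) F r ⟩
      (divX ℓ ⋆ r) ⋆ F       ≋⟨ ⋆-cong ℓ/𝕏⋆r≋1 ≋-refl ⟩
      𝟙 ⋆ F                  ≋⟨ ⋆-identityˡ F ⟩
      F                      ∎≋
      where F = divX (exp ⊟ 𝟙) ⊚ ℓ

  -- log_λ (e_λ t) = t, because exp (λ log e_λ t) = 1 + λ t.
  L⊚ℓ≋𝕏 : L ⊚ ℓ ≋ 𝕏
  L⊚ℓ≋𝕏 =
    L ⊚ ℓ                                        ≋⟨ ⊚-• (lam ⁻¹) _ ℓ ⟩
    lam ⁻¹ • ((exp ⊚ λ𝕏 ⊟ 𝟙) ⊚ ℓ)                ≋⟨ •-cong refl (⊚-⊟ (exp ⊚ λ𝕏) 𝟙 ℓ) ⟩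
    lam ⁻¹ • ((exp ⊚ λ𝕏) ⊚ ℓ ⊟ 𝟙 ⊚ ℓ)            ≋⟨ •-cong refl (λ n → +-cong (⊚-assoc exp λ𝕏 ℓ λ𝕏₀≈0 ℓ₀≈0 n) (-‿cong (⊚-𝟙 ℓ n))) ⟩
    lam ⁻¹ • (exp ⊚ (λ𝕏 ⊚ ℓ) ⊟ 𝟙)                ≋⟨ •-cong refl (λ n → +-congʳ (⊚-congʳ exp λ𝕏⊚ℓ≋log1p⊚λ𝕏 n)) ⟩
    lam ⁻¹ • (exp ⊚ (log1p ⊚ λ𝕏) ⊟ 𝟙)            ≋⟨ •-cong refl (λ n → +-congʳ (exp⊚log1p⊚λ𝕏 n)) ⟩
    lam ⁻¹ • ((𝟙 ⊞ λ𝕏) ⊟ 𝟙)                      ≋⟨ unscale ⟩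
    𝕏                                            ∎≋
    where
    λ𝕏⊚ℓ≋log1p⊚λ𝕏 : λ𝕏 ⊚ ℓ ≋ log1p ⊚ λ𝕏
    λ𝕏⊚ℓ≋log1p⊚λ𝕏 =
      λ𝕏 ⊚ ℓ             ≋⟨ ⊚-• lam 𝕏 ℓ ⟩
      lam • (𝕏 ⊚ ℓ)      ≋⟨ •-cong refl (𝕏-⊚ ℓ ℓ₀≈0) ⟩
      lam • ℓ            ≋⟨ (λ n → x*[x⁻¹*y]≈y _ lam≉0) ⟩
      log1p ⊚ λ𝕏         ∎≋
    exp⊚log1p⊚λ𝕏 : exp ⊚ (log1p ⊚ λ𝕏) ≋ 𝟙 ⊞ λ𝕏
    exp⊚log1p⊚λ𝕏 =
      exp ⊚ (log1p ⊚ λ𝕏)       ≋⟨ ⊚-assoc exp log1p λ𝕏 refl λ𝕏₀≈0 ⟨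
      (exp ⊚ log1p) ⊚ λ𝕏       ≋⟨ ⊚-congˡ λ𝕏 exp⊚log1p≋1+𝕏 ⟩
      (𝟙 ⊞ 𝕏) ⊚ λ𝕏             ≋⟨ ⊚-⊞ 𝟙 𝕏 λ𝕏 ⟩
      𝟙 ⊚ λ𝕏 ⊞ 𝕏 ⊚ λ𝕏          ≋⟨ (λ n → +-cong (⊚-𝟙 λ𝕏 n) (𝕏-⊚ λ𝕏 λ𝕏₀≈0 n)) ⟩
      𝟙 ⊞ λ𝕏                   ∎≋
    unscale : lam ⁻¹ • ((𝟙 ⊞ λ𝕏) ⊟ 𝟙) ≋ 𝕏
    unscale n = begin
      lam ⁻¹ * ((𝟙 n + lam * 𝕏 n) - 𝟙 n)    ≈⟨ *-congˡ (solve 3 (λ a l x → (a :+ l :* x) :- a := l :* x) refl (𝟙 n) lam (𝕏 n)) ⟩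
      lam ⁻¹ * (lam * 𝕏 n)                 ≈⟨ x⁻¹*[x*y]≈y (𝕏 n) lam≉0 ⟩
      𝕏 n                                  ∎

  L≋D⋆G : L ≋ D ⋆ G
  L≋D⋆G =
    L                            ≋⟨ split-𝕏₀ L L₀≈0 ⟩
    𝕏 ⋆ divX L                   ≋⟨ ⋆-identityˡ _ ⟨
    𝟙 ⋆ (𝕏 ⋆ divX L)             ≋⟨ ⋆-cong ψφ≋1 ≋-refl ⟨
    (ψ ⋆ φ) ⋆ (𝕏 ⋆ divX L)       ≋⟨ solveS 4 (λ p f x l → (p ⊗ f) ⊗ (x ⊗ l) ≔ (x ⊗ p) ⊗ (l ⊗ f)) ≋-refl ψ φ 𝕏 (divX L) ⟩
    (𝕏 ⋆ ψ) ⋆ (divX L ⋆ φ)       ≋⟨ ⋆-cong D≋𝕏⋆ψ ≋-refl ⟨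
    D ⋆ G                        ∎≋
    where
    L₀≈0 : L 0 ≈ 0#
    L₀≈0 = trans (*-congˡ (trans (+-congʳ (trans (⊚-coeff-0 exp λ𝕏) exp-coeff-0)) (-‿inverseʳ _))) (zeroʳ _)

  module CompositionalInverse (ebar : PS R) (ebar₀≈0 : ebar 0 ≈ 0#) (eYλ∘ebar≋𝕏 : _∘S_ R (eYλ R lam) ebar ≋ 𝕏) where

    W : PS R
    W = ℓ ⊚ ebar

    W₀≈0 : W 0 ≈ 0#
    W₀≈0 = trans (⊚-coeff-0 ℓ ebar) ℓ₀≈0

    D⊚W≋𝕏 : D ⊚ W ≋ 𝕏
    D⊚W≋𝕏 =
      D ⊚ (ℓ ⊚ ebar)       ≋⟨ ⊚-assoc D ℓ ebar ℓ₀≈0 ebar₀≈0 ⟨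
      (D ⊚ ℓ) ⊚ ebar       ≋⟨ ⊚-congˡ ebar eYλ≋D⊚ℓ ⟨
      eYλ R lam ⊚ ebar     ≋⟨ ∘S≋⊚ _ ebar ⟨
      _∘S_ R (eYλ R lam) ebar ≋⟨ eYλ∘ebar≋𝕏 ⟩
      𝕏                    ∎≋

    ebar≋𝕏⋆G⊚W : ebar ≋ 𝕏 ⋆ (G ⊚ W)
    ebar≋𝕏⋆G⊚W =
      ebar                 ≋⟨ 𝕏-⊚ ebar ebar₀≈0 ⟨
      𝕏 ⊚ ebar             ≋⟨ ⊚-congˡ ebar L⊚ℓ≋𝕏 ⟨
      (L ⊚ ℓ) ⊚ ebar       ≋⟨ ⊚-assoc L ℓ ebar ℓ₀≈0 ebar₀≈0 ⟩
      L ⊚ W                ≋⟨ ⊚-congˡ W L≋D⋆G ⟩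
      (D ⋆ G) ⊚ W          ≋⟨ ⊚-⋆ D G W W₀≈0 ⟩
      (D ⊚ W) ⋆ (G ⊚ W)    ≋⟨ ⋆-cong D⊚W≋𝕏 ≋-refl ⟩
      𝕏 ⋆ (G ⊚ W)          ∎≋

    ebar^k-coeff : ∀ k m → _^S_ R ebar k (k ℕ.+ m) ≈ ((G ^ k) ⊚ W) m
    ebar^k-coeff k m = begin
      _^S_ R ebar k (k ℕ.+ m)           ≈⟨ ^S≋^ ebar k _ ⟩
      (ebar ^ k) (k ℕ.+ m)              ≈⟨ ^-cong k ebar≋𝕏⋆G⊚W _ ⟩
      ((𝕏 ⋆ (G ⊚ W)) ^ k) (k ℕ.+ m)     ≈⟨ ^-distrib-⋆ 𝕏 (G ⊚ W) k _ ⟩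
      (𝕏 ^ k ⋆ (G ⊚ W) ^ k) (k ℕ.+ m)   ≈⟨ 𝕏^⋆-coeff k m _ ⟩
      ((G ⊚ W) ^ k) m                   ≈⟨ ⊚-^ G W k W₀≈0 m ⟨
      ((G ^ k) ⊚ W) m                     ∎

    open LagrangeInversion ψ φ ψφ≋1 using (lagrange)

    lagrange-G^k : ∀ k m → nat R (suc m) * ((G ^ k) ⊚ W) (suc m) ≈
                           _⊛_ R (_^S_ R (tOverD R) (suc m)) (deriv R (_^S_ R (logλExpOverD R lam) k)) m
    lagrange-G^k k m = begin
      nat R (suc m) * ((G ^ k) ⊚ W) (suc m)
        ≈⟨ lagrange W W₀≈0 (≋-trans (⊚-congˡ W (≋-sym D≋𝕏⋆ψ)) D⊚W≋𝕏) (G ^ k) m ⟩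
      (φ ^ suc m ⋆ ∂ (G ^ k)) m
        ≈⟨ ⋆-cong (^S≋^ φ (suc m)) (≋-trans (deriv≋∂ _) (∂-cong (≋-trans (^S≋^ _ k) (^-cong k logλExpOverD≋G)))) m ⟨
      (_^S_ R φ (suc m) ⋆ deriv R (_^S_ R (logλExpOverD R lam) k)) m
        ≈⟨ ⊛≋⋆ _ _ m ⟨
      _⊛_ R (_^S_ R φ (suc m)) (deriv R (_^S_ R (logλExpOverD R lam) k)) m ∎

    coefficient-formula : ∀ k m →
      (nat R (k !)) ⁻¹ * _^S_ R ebar k (k ℕ.+ suc m) ≈
      (nat R (suc m ℕ.* k !)) ⁻¹ * _⊛_ R (_^S_ R (tOverD R) (suc m)) (deriv R (_^S_ R (logλExpOverD R lam) k)) m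
    coefficient-formula k m = begin
      (nat R (k !)) ⁻¹ * _^S_ R ebar k (k ℕ.+ suc m)
        ≈⟨ *-congˡ (ebar^k-coeff k (suc m)) ⟩
      (nat R (k !)) ⁻¹ * ((G ^ k) ⊚ W) (suc m)
        ≈⟨ x⁻¹*y≈[z*x]⁻¹*[z*y] _ (nat-suc≉0 m) (nat-!≉0 k) ⟩
      (nat R (suc m) * nat R (k !)) ⁻¹ * (nat R (suc m) * ((G ^ k) ⊚ W) (suc m))
        ≈⟨ *-cong (⁻¹-cong (sym (nat-homo-* (suc m) (k !)))) (lagrange-G^k k m) ⟩
      (nat R (suc m ℕ.* k !)) ⁻¹ * _⊛_ R (_^S_ R (tOverD R) (suc m)) (deriv R (_^S_ R (logλExpOverD R lam) k)) m ∎

open import Data.Nat using (_*_)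

lemma5p1 : (R : RealField) → (lam : RealField.Carrier R) → ¬ (RealField._≈_ R lam (RealField.0# R)) →
           (ebar : PS R) → RealField._≈_ R (ebar 0) (RealField.0# R) →
           (∀ m → RealField._≈_ R (_∘S_ R (eYλ R lam) ebar m) (X R m)) →
           (k n : ℕ) → suc k ≤ n →
           RealField._≈_ R
             (RealField._*_ R (RealField._⁻¹ R (nat R (k !))) (_^S_ R ebar k n))
             (RealField._*_ R (RealField._⁻¹ R (nat R ((n ∸ k) * (k !))))
               (_⊛_ R (_^S_ R (tOverD R) (n ∸ k)) (deriv R (_^S_ R (logλExpOverD R lam) k)) (n ∸ k ∸ 1)))
lemma5p1 R lam lam≉0 ebar ebar₀≈0 eYλ∘ebar≋X k n 1+k≤n
  with m , ≡.refl ← ℕ.m≤n⇒∃[o]m+o≡n 1+k≤n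
  rewrite ≡.sym (ℕ.+-suc k m) | ℕ.m+n∸m≡n k (suc m) =
  DegenerateExponentialSeries.CompositionalInverse.coefficient-formula R lam lam≉0 ebar ebar₀≈0 eYλ∘ebar≋X k m
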